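{- Fix $k\in\mathbb Z_{\ge0}$ and let $(r,t,s)$ be a vertex of the Farey tree $\mathrm{F}\mathbb T$ with $t\in(0,1)$, $r\ne\frac01$ and $s\ne\frac11$. Let $F^-(k,t)$ denote the Hirzebruch–Jung expansion of the value of $F^+(k,t)$, and $G^-(k,r)$, $G^-(k,s)$ the Hirzebruch–Jung expansions of the values of $G^+(k,r)$, $G^+(k,s)$. Then \[F^-(k,t)=[[\,G^-(k,r),\,3k+4,\,G^-(k,s)\,]],\] i.e. the Hirzebruch–Jung expansion of $F^+(k,t)$ is the concatenation of the entries of $G^-(k,r)$, the single entry $3k+4$, and the entries of $G^-(k,s)$.
   Context: Farey tree $\mathrm{F}\mathbb T$: root $\left(\frac01,\frac11,\frac10\right)$; vertex $\left(\frac ab,\frac cd,\frac ef\right)$ has left child $\left(\frac ab,\frac{a+c}{b+d},\frac cd\right)$ and right child $\left(\frac cd,\frac{c+e}{d+f},\frac ef\right)$. Construction for an irreducible fraction $t=a/b$ ($a,b\ge1$): let $L_t$ be the segment from $(0,0)$ to $(b,a)$, oriented left to right. The pre-snake graph is the union of the closed unit lattice squares whose interiors meet $L_t$, each split by its upper-left-to-lower-right diagonal into two right triangles; edges are square sides and these diagonals. Signs: each triangle gets one sign, $-$ if it is the first triangle met by $L_t$ or if its part lying above the line through $L_t$ is a quadrilateral, else $+$; each edge meeting the interior of $L_t$ gets $k$ copies of one sign, $-$ if its midpoint lies on or above the line through $L_t$, $+$ if strictly below. Listing the signs in the order $L_t$ passes through triangles and edges and letting $a_1,\dots,a_\ell$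 be the lengths of successive maximal blocks of equal signs gives $F^+(k,t)=[a_1,\dots,a_\ell]=a_1+\cfrac1{a_2+\cfrac1{\ddots+\cfrac1{a_\ell}}}$. $G^+(k,t)$ is obtained the same way except that the $k$ signs on the central edge (the edge containing the midpoint $(b/2,a/2)$ of $L_t$) are $+$ instead of $-$. Every rational $x>1$ has a unique Hirzebruch–Jung expansion $[[b_1,\dots,b_s]]:=b_1-\cfrac1{b_2-\cfrac1{\ddots-\cfrac1{b_s}}}$ with integers $b_i\ge2$. -}

module Defs where

open import Data.Bool using (Bool; true; false; if_then_else_; _∧_; not)
open import Data.Nat using (ℕ; zero; suc; _+_; _*_; _∸_; _≤_; _<_; _<ᵇ_; _≤ᵇ_; _≡ᵇ_)
open import Data.List using (List; []; _∷_; _++_; [_]; concatMap; upTo; foldl; replicate; length)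
open import Data.List.Relation.Unary.All using (All)
open import Data.Product using (_×_; _,_; proj₁; proj₂)
open import Relation.Binary.PropositionalEquality using (_≡_)
open import Relation.Nullary using (yes; no)
import Data.Integer as ℤ
open ℤ using (ℤ; +_)
import Data.Rational as Q
open Q using (ℚ; 0ℚ)

Pt : Set
Pt = ℕ × ℕ

-- A fraction a/b is represented by the pair (a , b)  (numerator , denominator).
Frac : Set
Frac = ℕ × ℕ

-- The pre-snake graph of t = a/b.
-- L_t is the segment from (0,0) to (b,a); the line through it is  b·y = a·x.

-- The open unit square (i,i+1)×(j,j+1) meets the (open) segment L_t.
-- (0 ≤ i < b, 0 ≤ j < a, and the line y = a x / b takes, on x ∈ (i,i+1),
--  values in (a i / b , a (i+1) / b), which must meet (j , j+1).)
squareMet : (a b i j : ℕ) → Bool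
squareMet a b i j = (i <ᵇ b) ∧ (j <ᵇ a) ∧ (a * i <ᵇ b * suc j) ∧ (b * j <ᵇ a * suc i)

-- The squares met by L_t, in the order L_t passes through them
-- (L_t has positive slope, so it visits them in order of increasing i + j).
squares : (a b : ℕ) → List Pt
squares a b =
  concatMap (λ n → concatMap (λ i → if squareMet a b i (n ∸ i) then [ (i , n ∸ i) ] else [])
                             (upTo (suc n)))
            (upTo (a + b))

data Item : Set where
  tri  : Pt → Pt → Pt → Item
  edge : Pt → Pt → Item

-- Inside square (i,j) (lower-left corner (i,j)) L_t first passes the lower-left
-- triangle, then the diagonal (from upper-left to lower-right), then the
-- upper-right triangle.
squareItems : Pt → List Item
squareItems (i , j) =
  tri (i , j) (suc i , j) (i , suc j)
  ∷ edge (i , suc j) (suc i , j)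
  ∷ tri (suc i , suc j) (suc i , j) (i , suc j)
  ∷ []

commonSide : Pt → Pt → Item
commonSide (i , j) (i' , j') =
  if i' ≡ᵇ suc i then edge (suc i , j) (suc i , suc j)
                 else edge (i , suc j) (suc i , suc j)

items : List Pt → List Item
items [] = []
items (p ∷ []) = squareItems p
items (p ∷ q ∷ rest) = squareItems p ++ commonSide p q ∷ items (q ∷ rest)

-- Signs.  We encode + as true and − as false.

strictlyAbove : (a b : ℕ) → Pt → Bool
strictlyAbove a b (x , y) = a * x <ᵇ b * y

count : Bool → ℕ
count true = 1
count false = 0

-- The part of a triangle lying above the line (which crosses its interior)
-- is the convex hull of the triangle's vertices above the line and the two
-- crossing points; it is a quadrilateral iff exactly two vertices lie
-- strictly above the line.
aboveIsQuadrilateral : (a b : ℕ) → Pt → Pt → Pt → Bool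
aboveIsQuadrilateral a b p q r =
  (count (strictlyAbove a b p) + count (strictlyAbove a b q) + count (strictlyAbove a b r)) ≡ᵇ 2

-- The midpoint of the segment p q lies on or above the line:
-- with doubled coordinates (X , Y) = p + q, this is a·X ≤ b·Y.
midOnOrAbove : (a b : ℕ) → Pt → Pt → Bool
midOnOrAbove a b (x₁ , y₁) (x₂ , y₂) = a * (x₁ + x₂) ≤ᵇ b * (y₁ + y₂)

-- The closed segment p q contains the midpoint (b/2 , a/2) of L_t.
-- Working with doubled coordinates: P = (b , a), endpoints 2p, 2q.
containsCentre : (a b : ℕ) → Pt → Pt → Bool
containsCentre a b (x₁ , y₁) (x₂ , y₂) =
  collinear ∧ between (2 * x₁) b (2 * x₂) ∧ between (2 * y₁) a (2 * y₂)
  where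
  z : ℕ → ℤ
  z n = + n
  collinear : Bool
  collinear with ((z (2 * x₂) ℤ.- z (2 * x₁)) ℤ.* (z a ℤ.- z (2 * y₁)))
                 ℤ.≟ ((z (2 * y₂) ℤ.- z (2 * y₁)) ℤ.* (z b ℤ.- z (2 * x₁)))
  ... | yes _ = true
  ... | no _ = false
  between : ℕ → ℕ → ℕ → Bool
  between u v w = ((u ≤ᵇ v) ∧ (v ≤ᵇ w)) Data.Bool.∨ ((w ≤ᵇ v) ∧ (v ≤ᵇ u))

-- Signs contributed by an item other than the first triangle.
-- The flag `flipCentre` is false for F⁺ and true for G⁺ (in which the k signs
-- on the central edge are + instead of −).
itemSigns : (flipCentre : Bool) (k a b : ℕ) → Item → List Bool
itemSigns fc k a b (tri p q r) = [ not (aboveIsQuadrilateral a b p q r) ]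
itemSigns fc k a b (edge p q) =
  replicate k (if fc ∧ containsCentre a b p q then true else not (midOnOrAbove a b p q))

signList : (flipCentre : Bool) (k a b : ℕ) → List Item → List Bool
signList fc k a b [] = []
signList fc k a b (tri _ _ _ ∷ rest) = false ∷ concatMap (itemSigns fc k a b) rest
signList fc k a b (edge p q ∷ rest) = concatMap (itemSigns fc k a b) (edge p q ∷ rest)

signSeq : (flipCentre : Bool) (k : ℕ) → Frac → List Bool
signSeq fc k (a , b) = signList fc k a b (items (squares a b))

sameB : Bool → Bool → Bool
sameB true true = true
sameB false false = true
sameB _ _ = false

runsFrom : Bool → ℕ → List Bool → List ℕ
runsFrom c n [] = [ n ]
runsFrom c n (y ∷ ys) = if sameB y c then runsFrom c (suc n) ys else n ∷ runsFrom y 1 ys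

runs : List Bool → List ℕ
runs [] = []
runs (x ∷ xs) = runsFrom x 1 xs

-- reciprocal (only ever applied to nonzero values below; 1/0 := 0 by convention)
inv : ℚ → ℚ
inv p with p Q.≟ 0ℚ
... | yes _ = 0ℚ
... | no p≢0 = Q.1/_ p {{Q.≢-nonZero p≢0}}

ℕtoℚ : ℕ → ℚ
ℕtoℚ n = (+ n) Q./ 1

cf : List ℕ → ℚ
cf [] = 0ℚ
cf (x ∷ []) = ℕtoℚ x
cf (x ∷ y ∷ xs) = ℕtoℚ x Q.+ inv (cf (y ∷ xs))

hj : List ℕ → ℚ
hj [] = 0ℚ
hj (x ∷ []) = ℕtoℚ x
hj (x ∷ y ∷ xs) = ℕtoℚ x Q.- inv (hj (y ∷ xs))

IsHJ : ℚ → List ℕ → Set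
IsHJ q l = (0 < length l) × All (2 ≤_) l × (hj l ≡ q)

F⁺ : ℕ → Frac → ℚ
F⁺ k t = cf (runs (signSeq false k t))

G⁺ : ℕ → Frac → ℚ
G⁺ k t = cf (runs (signSeq true k t))

data Dir : Set where
  left right : Dir

Vertex : Set
Vertex = Frac × Frac × Frac

mediant : Frac → Frac → Frac
mediant (a , b) (c , d) = (a + c , b + d)

child : Vertex → Dir → Vertex
child (x , y , z) left  = (x , mediant x y , y)
child (x , y , z) right = (y , mediant y z , z)

root : Vertex
root = ((0 , 1) , (1 , 1) , (1 , 0))

vertexAt : List Dir → Vertex
vertexAt ds = foldl child root ds

vL vM vR : List Dir → Frac
vL p = proj₁ (vertexAt p)
vM p = proj₁ (proj₂ (vertexAt p))
vR p = proj₂ (proj₂ (vertexAt p))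

-- Let r = a/b and s = c/d be the Farey parents of t = (a + c)/(b + d), so b c − a d = 1.
-- The squares met by L_t are those met by L_r, one junction square with lower-right
-- corner (b , a), and those met by L_s translated by (b , a).  By unimodularity no lattice
-- point lies strictly between the line of t and that of r, or the translated line of s,
-- so every triangle and edge keeps its sign; the central edges of L_r and L_s lie below
-- L_t, which matches their sign + in G⁺.  Hence the signs of F⁺(k, t) are those of
-- G⁺(k, r), then 3k + 2 signs − around the junction, then those of G⁺(k, s) with the
-- first one turned into +.  Converting regular continued fractions of sign runs into
-- Hirzebruch–Jung expansions block by block (cfToHJ), this splicing of signs becomes the
-- splicing of the single entry 3k + 4.

module Submission where

open import Defs

module HirzebruchJung where

  open import Data.Nat as ℕ using (ℕ; zero; suc; s≤s; z≤n)
  open import Data.Nat.Coprimality using (1-coprimeTo) renaming (sym to coprime-sym)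
  open import Data.List using (List; []; _∷_; _++_; replicate)
  open import Data.List.Properties using (++-assoc)
  open import Data.List.Relation.Unary.All using (All; []; _∷_)
  open import Data.List.Relation.Unary.All.Properties using (++⁺; replicate⁺)
  open import Data.Product using (_,_)
  open import Data.Empty using (⊥-elim)
  open import Relation.Binary.PropositionalEquality
  open import Relation.Nullary using (yes; no)
  import Data.Integer as ℤ
  open import Data.Integer.Tactic.RingSolver using (solve-∀)
  import Data.Rational.Unnormalised as ℚᵘ
  import Data.Rational.Unnormalised.Properties as ℚᵘ
  open import Data.Rational using (ℚ; mkℚ; 0ℚ; 1ℚ; _+_; _-_; _*_; Positive; NonNegative; 1/_; _≟_; toℚᵘ)
  open import Data.Rational.Properties
    using (normalize-coprime; toℚᵘ-injective; toℚᵘ-homo-+; pos⇒nonZero; positive⁻¹; <⇒≢;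
           1/pos⇒pos; *-inverseˡ; *-identityˡ; *-identityʳ; *-assoc; +-identityˡ; +-comm; +-assoc;
           pos+pos⇒pos; nonNeg+pos⇒pos)
  open import Data.Rational.Solver using (module +-*-Solver)
  open +-*-Solver

  ℕtoℚ≡mkℚ : ∀ n → ℕtoℚ n ≡ mkℚ (ℤ.+ n) 0 (coprime-sym (1-coprimeTo n))
  ℕtoℚ≡mkℚ n = normalize-coprime (coprime-sym (1-coprimeTo n))

  ℕtoℚ-suc : ∀ n → ℕtoℚ (suc n) ≡ 1ℚ + ℕtoℚ n
  ℕtoℚ-suc n = toℚᵘ-injective (ℚᵘ.≃-trans suc≃1+ (ℚᵘ.≃-sym (toℚᵘ-homo-+ 1ℚ (ℕtoℚ n))))
    where
    cross : ∀ (m : ℤ.ℤ) → (ℤ.+ 1 ℤ.+ m) ℤ.* (ℤ.+ 1 ℤ.* ℤ.+ 1) ≡ (ℤ.+ 1 ℤ.* ℤ.+ 1 ℤ.+ m ℤ.* ℤ.+ 1) ℤ.* ℤ.+ 1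
    cross = solve-∀
    suc≃1+ : toℚᵘ (ℕtoℚ (suc n)) ℚᵘ.≃ (toℚᵘ 1ℚ ℚᵘ.+ toℚᵘ (ℕtoℚ n))
    suc≃1+ rewrite ℕtoℚ≡mkℚ (suc n) | ℕtoℚ≡mkℚ n = ℚᵘ.*≡* (cross (ℤ.+ n))

  ℕtoℚ-nonNegative : ∀ n → NonNegative (ℕtoℚ n)
  ℕtoℚ-nonNegative n = subst NonNegative (sym (ℕtoℚ≡mkℚ n)) _

  ℕtoℚ-suc-positive : ∀ n → Positive (ℕtoℚ (suc n))
  ℕtoℚ-suc-positive n = subst Positive (sym (ℕtoℚ≡mkℚ (suc n))) _

  inv≡1/ : ∀ p .{{_ : Positive p}} → inv p ≡ (1/ p) {{pos⇒nonZero p}}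
  inv≡1/ p with p ≟ 0ℚ
  ... | yes p≡0 = ⊥-elim (<⇒≢ (positive⁻¹ p) (sym p≡0))
  ... | no _ = refl

  inv-positive : ∀ p .{{_ : Positive p}} → Positive (inv p)
  inv-positive p = subst Positive (sym (inv≡1/ p)) (1/pos⇒pos p)

  inv-inverseˡ : ∀ p .{{_ : Positive p}} → inv p * p ≡ 1ℚ
  inv-inverseˡ p = trans (cong (_* p) (inv≡1/ p)) (*-inverseˡ p {{pos⇒nonZero p}})

  inv-unique : ∀ p q .{{_ : Positive p}} → p * q ≡ 1ℚ → inv p ≡ q
  inv-unique p q pq≡1 = begin
    inv p             ≡⟨ *-identityʳ (inv p) ⟨
    inv p * 1ℚ        ≡⟨ cong (inv p *_) pq≡1 ⟨
    inv p * (p * q)   ≡⟨ *-assoc (inv p) p q ⟨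
    (inv p * p) * q   ≡⟨ cong (_* q) (inv-inverseˡ p) ⟩
    1ℚ * q            ≡⟨ *-identityˡ q ⟩
    q                 ∎
    where open ≡-Reasoning

  inv-involutive : ∀ p .{{_ : Positive p}} → inv (inv p) ≡ p
  inv-involutive p = inv-unique (inv p) p {{inv-positive p}} (inv-inverseˡ p)

  1-inv[1+inv] : ∀ u .{{_ : Positive u}} → 1ℚ - inv (1ℚ + inv u) ≡ inv (u + 1ℚ)
  1-inv[1+inv] u = begin
    1ℚ - inv (1ℚ + inv u)   ≡⟨ cong (1ℚ -_) inv[1+inv]≡u*w ⟩
    1ℚ - u * w              ≡⟨ cong (_- u * w) w[u+1]≡1 ⟨
    w * (u + 1ℚ) - u * w    ≡⟨ solve 2 (λ u w → w :* (u :+ con 1ℚ) :- u :* w := w) refl u w ⟩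
    w                       ∎
    where
    open ≡-Reasoning
    instance
      u+1-positive : Positive (u + 1ℚ)
      u+1-positive = pos+pos⇒pos u 1ℚ
      inv-u-positive : Positive (inv u)
      inv-u-positive = inv-positive u
      1+inv-u-positive : Positive (1ℚ + inv u)
      1+inv-u-positive = pos+pos⇒pos 1ℚ (inv u)
    w : ℚ
    w = inv (u + 1ℚ)
    w[u+1]≡1 : w * (u + 1ℚ) ≡ 1ℚ
    w[u+1]≡1 = inv-inverseˡ (u + 1ℚ)
    [1+inv]uw≡1 : (1ℚ + inv u) * (u * w) ≡ 1ℚ
    [1+inv]uw≡1 = begin
      (1ℚ + inv u) * (u * w)                  ≡⟨ solve 3 (λ u v w → (con 1ℚ :+ v) :* (u :* w)
                                                    := w :* (u :+ con 1ℚ) :+ (v :* u :- con 1ℚ) :* w) refl u (inv u) w ⟩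
      w * (u + 1ℚ) + (inv u * u - 1ℚ) * w     ≡⟨ cong₂ (λ x y → x + (y - 1ℚ) * w) w[u+1]≡1 (inv-inverseˡ u) ⟩
      1ℚ + (1ℚ - 1ℚ) * w                      ≡⟨ solve 1 (λ w → con 1ℚ :+ (con 1ℚ :- con 1ℚ) :* w := con 1ℚ) refl w ⟩
      1ℚ                                      ∎
    inv[1+inv]≡u*w : inv (1ℚ + inv u) ≡ u * w
    inv[1+inv]≡u*w = inv-unique (1ℚ + inv u) (u * w) [1+inv]uw≡1

  -- The step behind [[x + 1, 2^m, …]] = [x, m + 1, …] (see cfToHJ below).
  hj-cf-step : ∀ x m y .{{_ : Positive y}} →
    ℕtoℚ (suc x) - inv (1ℚ + inv (ℕtoℚ m + inv y)) ≡ ℕtoℚ x + inv (ℕtoℚ (suc m) + inv y)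
  hj-cf-step x m y = begin
    ℕtoℚ (suc x) - inv (1ℚ + inv u)       ≡⟨ cong (_- inv (1ℚ + inv u)) (ℕtoℚ-suc x) ⟩
    1ℚ + ℕtoℚ x - inv (1ℚ + inv u)        ≡⟨ solve 3 (λ o x v → o :+ x :- v := x :+ (o :- v)) refl 1ℚ (ℕtoℚ x) (inv (1ℚ + inv u)) ⟩
    ℕtoℚ x + (1ℚ - inv (1ℚ + inv u))      ≡⟨ cong (ℕtoℚ x +_) (1-inv[1+inv] u {{u-positive}}) ⟩
    ℕtoℚ x + inv (u + 1ℚ)                 ≡⟨ cong (λ v → ℕtoℚ x + inv v) u+1≡suc ⟩
    ℕtoℚ x + inv (ℕtoℚ (suc m) + inv y)   ∎
    where
    open ≡-Reasoning
    u : ℚ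
    u = ℕtoℚ m + inv y
    u-positive : Positive u
    u-positive = nonNeg+pos⇒pos (ℕtoℚ m) {{ℕtoℚ-nonNegative m}} (inv y) {{inv-positive y}}
    u+1≡suc : u + 1ℚ ≡ ℕtoℚ (suc m) + inv y
    u+1≡suc = begin
      ℕtoℚ m + inv y + 1ℚ   ≡⟨ solve 3 (λ a b c → a :+ b :+ c := (c :+ a) :+ b) refl (ℕtoℚ m) (inv y) 1ℚ ⟩
      1ℚ + ℕtoℚ m + inv y   ≡⟨ cong (_+ inv y) (ℕtoℚ-suc m) ⟨
      ℕtoℚ (suc m) + inv y  ∎

  cf-positive : ∀ x l → All (1 ℕ.≤_) (x ∷ l) → Positive (cf (x ∷ l))
  cf-positive zero _ (() ∷ _)
  cf-positive (suc x) [] _ = ℕtoℚ-suc-positive x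
  cf-positive (suc x) (y ∷ l) (_ ∷ pos) =
    nonNeg+pos⇒pos (ℕtoℚ (suc x)) {{ℕtoℚ-nonNegative (suc x)}}
                   (inv (cf (y ∷ l))) {{inv-positive (cf (y ∷ l)) {{cf-positive y l pos}}}}

  hjWithLast : List ℕ → ℚ → ℚ
  hjWithLast [] z = z
  hjWithLast (x ∷ l) z = ℕtoℚ x - inv (hjWithLast l z)

  hj-++ : ∀ l z zs → hj (l ++ z ∷ zs) ≡ hjWithLast l (hj (z ∷ zs))
  hj-++ [] z zs = refl
  hj-++ (x ∷ []) z zs = refl
  hj-++ (x ∷ y ∷ l) z zs = cong (λ v → ℕtoℚ x - inv v) (hj-++ (y ∷ l) z zs)

  hj-suc : ∀ x l → hj (suc x ∷ l) ≡ 1ℚ + hj (x ∷ l)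
  hj-suc x [] = ℕtoℚ-suc x
  hj-suc x (y ∷ l) = trans (cong (_- inv (hj (y ∷ l))) (ℕtoℚ-suc x)) (+-assoc 1ℚ (ℕtoℚ x) _)

  hjWithLast-twos : ∀ m y .{{_ : Positive y}} →
    hjWithLast (replicate m 2) (1ℚ + y) ≡ 1ℚ + inv (ℕtoℚ m + inv y)
  hjWithLast-twos zero y =
    cong (1ℚ +_) (sym (trans (cong inv (+-identityˡ (inv y))) (inv-involutive y)))
  hjWithLast-twos (suc m) y = begin
    ℕtoℚ 2 - inv (hjWithLast (replicate m 2) (1ℚ + y))  ≡⟨ cong (λ v → ℕtoℚ 2 - inv v) (hjWithLast-twos m y) ⟩
    ℕtoℚ 2 - inv (1ℚ + inv (ℕtoℚ m + inv y))           ≡⟨ hj-cf-step 1 m y ⟩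
    1ℚ + inv (ℕtoℚ (suc m) + inv y)                       ∎
    where open ≡-Reasoning

  data EvenLength {A : Set} : List A → Set where
    even[] : EvenLength []
    even∷∷ : ∀ {x y l} → EvenLength l → EvenLength (x ∷ y ∷ l)

  -- The regular continued fraction [a₁, b₁, …, aₘ, bₘ] (all entries ≥ 1) has the
  -- Hirzebruch–Jung expansion [[a₁ + 1, 2^(b₁ − 1), a₂ + 2, 2^(b₂ − 1), …, aₘ + 2, 2^(bₘ − 1)]],
  -- where 2^n stands for n entries equal to 2.
  cfToHJ-tail : List ℕ → List ℕ
  cfToHJ-tail [] = []
  cfToHJ-tail (b ∷ []) = replicate (b ℕ.∸ 1) 2
  cfToHJ-tail (b ∷ a ∷ l) = replicate (b ℕ.∸ 1) 2 ++ suc (suc a) ∷ cfToHJ-tail l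

  cfToHJ : List ℕ → List ℕ
  cfToHJ [] = []
  cfToHJ (a ∷ l) = suc a ∷ cfToHJ-tail l

  replicate-suc-snoc : ∀ {A : Set} m (x : A) → replicate (suc m) x ≡ replicate m x ++ x ∷ []
  replicate-suc-snoc zero x = refl
  replicate-suc-snoc (suc m) x = cong (x ∷_) (replicate-suc-snoc m x)

  hj-cfToHJ : ∀ a b l → EvenLength l → All (1 ℕ.≤_) (a ∷ b ∷ l) → hj (cfToHJ (a ∷ b ∷ l)) ≡ cf (a ∷ b ∷ l)
  hj-cfToHJ a zero [] even[] (_ ∷ () ∷ _)
  hj-cfToHJ a (suc zero) [] even[] _ = trans (ℕtoℚ-suc a) (+-comm 1ℚ (ℕtoℚ a))
  hj-cfToHJ a (suc (suc m)) [] even[] _ = begin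
    hj (suc a ∷ replicate (suc m) 2)                       ≡⟨ cong (λ l → hj (suc a ∷ l)) (replicate-suc-snoc m 2) ⟩
    hj (suc a ∷ replicate m 2 ++ 2 ∷ [])                   ≡⟨ hj-++ (suc a ∷ replicate m 2) 2 [] ⟩
    ℕtoℚ (suc a) - inv (hjWithLast (replicate m 2) (1ℚ + 1ℚ)) ≡⟨ cong (λ v → ℕtoℚ (suc a) - inv v) (hjWithLast-twos m 1ℚ) ⟩
    ℕtoℚ (suc a) - inv (1ℚ + inv (ℕtoℚ m + inv 1ℚ))       ≡⟨ hj-cf-step a m 1ℚ ⟩
    ℕtoℚ a + inv (ℕtoℚ (suc m) + 1ℚ)
      ≡⟨ cong (λ v → ℕtoℚ a + inv v) (trans (ℕtoℚ-suc (suc m)) (+-comm 1ℚ (ℕtoℚ (suc m)))) ⟨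
    ℕtoℚ a + inv (ℕtoℚ (suc (suc m)))                      ∎
    where open ≡-Reasoning
  hj-cfToHJ a (suc m) (c ∷ e ∷ l) (even∷∷ even) (_ ∷ _ ∷ pos) = begin
    hj (suc a ∷ replicate m 2 ++ suc (suc c) ∷ tail)       ≡⟨ hj-++ (suc a ∷ replicate m 2) (suc (suc c)) tail ⟩
    ℕtoℚ (suc a) - inv (hjWithLast (replicate m 2) (hj (suc (suc c) ∷ tail)))
      ≡⟨ cong (λ v → ℕtoℚ (suc a) - inv (hjWithLast (replicate m 2) v)) (trans (hj-suc (suc c) tail) (cong (1ℚ +_) ih)) ⟩
    ℕtoℚ (suc a) - inv (hjWithLast (replicate m 2) (1ℚ + y)) ≡⟨ cong (λ v → ℕtoℚ (suc a) - inv v) (hjWithLast-twos m y) ⟩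
    ℕtoℚ (suc a) - inv (1ℚ + inv (ℕtoℚ m + inv y))         ≡⟨ hj-cf-step a m y ⟩
    ℕtoℚ a + inv (ℕtoℚ (suc m) + inv y)                    ∎
    where
    open ≡-Reasoning
    tail : List ℕ
    tail = cfToHJ-tail (e ∷ l)
    y : ℚ
    y = cf (c ∷ e ∷ l)
    instance
      y-positive : Positive y
      y-positive = cf-positive c (e ∷ l) pos
    ih : hj (suc c ∷ tail) ≡ y
    ih = hj-cfToHJ c e l even pos

  cfToHJ-≥2 : ∀ l → All (1 ℕ.≤_) l → All (2 ℕ.≤_) (cfToHJ l)
  cfToHJ-≥2 [] _ = []
  cfToHJ-≥2 (a ∷ l) (s≤s z≤n ∷ pos) = s≤s (s≤s z≤n) ∷ tail-≥2 l pos
    where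
    tail-≥2 : ∀ l → All (1 ℕ.≤_) l → All (2 ℕ.≤_) (cfToHJ-tail l)
    tail-≥2 [] _ = []
    tail-≥2 (b ∷ []) _ = replicate⁺ (b ℕ.∸ 1) (s≤s (s≤s z≤n))
    tail-≥2 (b ∷ a ∷ l) (_ ∷ _ ∷ pos) = ++⁺ (replicate⁺ (b ℕ.∸ 1) (s≤s (s≤s z≤n))) (s≤s (s≤s z≤n) ∷ tail-≥2 l pos)

  isHJ-cfToHJ : ∀ {l} → EvenLength l → l ≢ [] → All (1 ℕ.≤_) l → IsHJ (cf l) (cfToHJ l)
  isHJ-cfToHJ even[] []≢[] _ = ⊥-elim ([]≢[] refl)
  isHJ-cfToHJ {a ∷ b ∷ l} (even∷∷ even) _ pos = s≤s z≤n , cfToHJ-≥2 (a ∷ b ∷ l) pos , hj-cfToHJ a b l even pos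

  cfToHJ-++ : ∀ {l} x l′ → EvenLength l → l ≢ [] →
    cfToHJ (l ++ x ∷ l′) ≡ cfToHJ l ++ suc (suc x) ∷ cfToHJ-tail l′
  cfToHJ-++ x l′ even[] []≢[] = ⊥-elim ([]≢[] refl)
  cfToHJ-++ {a ∷ b ∷ l} x l′ (even∷∷ even) _ = cong (suc a ∷_) (tail-++ b l even)
    where
    tail-++ : ∀ b l → EvenLength l → cfToHJ-tail (b ∷ l ++ x ∷ l′) ≡ cfToHJ-tail (b ∷ l) ++ suc (suc x) ∷ cfToHJ-tail l′
    tail-++ b [] even[] = refl
    tail-++ b (c ∷ e ∷ l) (even∷∷ even) =
      trans (cong (λ t → replicate (b ℕ.∸ 1) 2 ++ suc (suc c) ∷ t) (tail-++ e l even))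
            (sym (++-assoc (replicate (b ℕ.∸ 1) 2) (suc (suc c) ∷ cfToHJ-tail (e ∷ l)) _))

module SignRuns where

  open HirzebruchJung
  open import Data.Bool using (Bool; true; false; not)
  open import Data.Nat using (suc; _+_; _≤_; s≤s; z≤n)
  open import Data.Nat.Properties using (+-suc; +-comm)
  open import Data.List using (List; []; _∷_; _++_; replicate)
  open import Data.List.Relation.Unary.All using (All; []; _∷_)
  open import Data.Product using (_×_; _,_; ∃₂)
  open import Relation.Binary.PropositionalEquality
  open import Function using (case_of_)

  lastOr : Bool → List Bool → Bool
  lastOr c [] = c
  lastOr c (y ∷ ys) = lastOr y ys

  lastOr-++ : ∀ c xs ys → lastOr c (xs ++ ys) ≡ lastOr (lastOr c xs) ys
  lastOr-++ c [] ys = refl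
  lastOr-++ c (x ∷ xs) ys = lastOr-++ x xs ys

  data OddLength {A : Set} : List A → Set where
    odd∷ : ∀ {x l} → EvenLength l → OddLength (x ∷ l)

  mutual
    runsFrom-even : ∀ c n xs → lastOr c xs ≡ not c → EvenLength (runsFrom c n xs)
    runsFrom-even true  n [] ()
    runsFrom-even false n [] ()
    runsFrom-even true  n (true  ∷ ys) e = runsFrom-even true (suc n) ys e
    runsFrom-even true  n (false ∷ ys) e = even-∷ (runsFrom-odd false 1 ys e)
    runsFrom-even false n (true  ∷ ys) e = even-∷ (runsFrom-odd true 1 ys e)
    runsFrom-even false n (false ∷ ys) e = runsFrom-even false (suc n) ys e

    runsFrom-odd : ∀ c n xs → lastOr c xs ≡ c → OddLength (runsFrom c n xs)
    runsFrom-odd c n [] e = odd∷ even[]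
    runsFrom-odd true  n (true  ∷ ys) e = runsFrom-odd true (suc n) ys e
    runsFrom-odd true  n (false ∷ ys) e = odd∷ (runsFrom-even false 1 ys e)
    runsFrom-odd false n (true  ∷ ys) e = odd∷ (runsFrom-even true 1 ys e)
    runsFrom-odd false n (false ∷ ys) e = runsFrom-odd false (suc n) ys e

    even-∷ : ∀ {x l} → OddLength l → EvenLength (x ∷ l)
    even-∷ (odd∷ e) = even∷∷ e

  runsFrom-positive : ∀ c n xs → All (1 ≤_) (runsFrom c (suc n) xs)
  runsFrom-positive c n [] = s≤s z≤n ∷ []
  runsFrom-positive true  n (true  ∷ ys) = runsFrom-positive true (suc n) ys
  runsFrom-positive true  n (false ∷ ys) = s≤s z≤n ∷ runsFrom-positive false 0 ys
  runsFrom-positive false n (true  ∷ ys) = s≤s z≤n ∷ runsFrom-positive true 0 ys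
  runsFrom-positive false n (false ∷ ys) = runsFrom-positive false (suc n) ys

  runsFrom-++-switch : ∀ c n xs ys →
    runsFrom c n (xs ++ not (lastOr c xs) ∷ ys) ≡ runsFrom c n xs ++ runsFrom (not (lastOr c xs)) 1 ys
  runsFrom-++-switch true  n [] ys = refl
  runsFrom-++-switch false n [] ys = refl
  runsFrom-++-switch true  n (true  ∷ xs) ys = runsFrom-++-switch true (suc n) xs ys
  runsFrom-++-switch true  n (false ∷ xs) ys = cong (n ∷_) (runsFrom-++-switch false 1 xs ys)
  runsFrom-++-switch false n (true  ∷ xs) ys = cong (n ∷_) (runsFrom-++-switch true 1 xs ys)
  runsFrom-++-switch false n (false ∷ xs) ys = runsFrom-++-switch false (suc n) xs ys

  runsFrom-replicate : ∀ c n m ys → runsFrom c n (replicate m c ++ ys) ≡ runsFrom c (m + n) ys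
  runsFrom-replicate c n 0 ys = refl
  runsFrom-replicate true n (suc m) ys =
    trans (runsFrom-replicate true (suc n) m ys) (cong (λ n′ → runsFrom true n′ ys) (+-suc m n))
  runsFrom-replicate false n (suc m) ys =
    trans (runsFrom-replicate false (suc n) m ys) (cong (λ n′ → runsFrom false n′ ys) (+-suc m n))

  runsFrom-suc : ∀ c n xs → ∃₂ λ h hs → runsFrom c n xs ≡ h ∷ hs × runsFrom c (suc n) xs ≡ suc h ∷ hs
  runsFrom-suc c n [] = n , [] , refl , refl
  runsFrom-suc true  n (true  ∷ ys) = runsFrom-suc true (suc n) ys
  runsFrom-suc true  n (false ∷ ys) = n , _ , refl , refl
  runsFrom-suc false n (true  ∷ ys) = n , _ , refl , refl
  runsFrom-suc false n (false ∷ ys) = runsFrom-suc false (suc n) ys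

  runsFrom≢[] : ∀ c n xs → runsFrom c n xs ≢ []
  runsFrom≢[] c n xs with runsFrom-suc c n xs
  ... | _ , _ , eq , _ = λ eq′ → case trans (sym eq) eq′ of λ ()

  isHJ-runs : ∀ xs → lastOr false xs ≡ true → IsHJ (cf (runs (false ∷ xs))) (cfToHJ (runs (false ∷ xs)))
  isHJ-runs xs last =
    isHJ-cfToHJ (runsFrom-even false 1 xs last) (runsFrom≢[] false 1 xs) (runsFrom-positive false 0 xs)

  cfToHJ-runs-splice : ∀ n gr gs → lastOr false gr ≡ true →
    cfToHJ (runs ((false ∷ gr) ++ replicate (suc n) false ++ true ∷ false ∷ gs))
      ≡ cfToHJ (runs (false ∷ gr)) ++ (n + 3) ∷ cfToHJ (runs (false ∷ false ∷ gs))
  cfToHJ-runs-splice n gr gs last with runsFrom-suc false 1 gs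
  ... | h , hs , runs≡h∷hs , runs₂≡suc-h∷hs = begin
    cfToHJ (runsFrom false 1 (gr ++ replicate (suc n) false ++ true ∷ false ∷ gs))
      ≡⟨ cong (λ c → cfToHJ (runsFrom false 1 (gr ++ not c ∷ middle))) last ⟨
    cfToHJ (runsFrom false 1 (gr ++ not (lastOr false gr) ∷ middle))
      ≡⟨ cong cfToHJ (runsFrom-++-switch false 1 gr middle) ⟩
    cfToHJ (runsFrom false 1 gr ++ runsFrom (not (lastOr false gr)) 1 middle)
      ≡⟨ cong (λ c → cfToHJ (runsFrom false 1 gr ++ runsFrom (not c) 1 middle)) last ⟩
    cfToHJ (runsFrom false 1 gr ++ runsFrom false 1 middle)
      ≡⟨ cong (λ r → cfToHJ (runsFrom false 1 gr ++ r)) (runsFrom-replicate false 1 n (true ∷ false ∷ gs)) ⟩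
    cfToHJ (runsFrom false 1 gr ++ (n + 1) ∷ 1 ∷ runsFrom false 1 gs)
      ≡⟨ cfToHJ-++ (n + 1) (1 ∷ runsFrom false 1 gs) (runsFrom-even false 1 gr last) (runsFrom≢[] false 1 gr) ⟩
    cfToHJ (runsFrom false 1 gr) ++ suc (suc (n + 1)) ∷ cfToHJ-tail (1 ∷ runsFrom false 1 gs)
      ≡⟨ cong₂ (λ x r → cfToHJ (runsFrom false 1 gr) ++ x ∷ cfToHJ-tail (1 ∷ r)) n+1+2≡n+3 runs≡h∷hs ⟩
    cfToHJ (runsFrom false 1 gr) ++ (n + 3) ∷ cfToHJ (suc h ∷ hs)
      ≡⟨ cong (λ r → cfToHJ (runsFrom false 1 gr) ++ (n + 3) ∷ cfToHJ r) runs₂≡suc-h∷hs ⟨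
    cfToHJ (runsFrom false 1 gr) ++ (n + 3) ∷ cfToHJ (runsFrom false 2 gs) ∎
    where
    open ≡-Reasoning
    middle : List Bool
    middle = replicate n false ++ true ∷ false ∷ gs
    n+1+2≡n+3 : suc (suc (n + 1)) ≡ n + 3
    n+1+2≡n+3 = trans (cong (λ m → suc (suc m)) (+-comm n 1)) (+-comm 3 n)

  isHJ-splice : ∀ n gr gs → lastOr false gr ≡ true → lastOr false gs ≡ true →
    IsHJ (cf (runs ((false ∷ gr) ++ replicate (suc n) false ++ true ∷ false ∷ gs)))
         (cfToHJ (runs (false ∷ gr)) ++ (n + 3) ∷ cfToHJ (runs (false ∷ false ∷ gs)))
  isHJ-splice n gr gs gr-last gs-last =
    subst (IsHJ (cf (runs (false ∷ signs)))) (cfToHJ-runs-splice n gr gs gr-last) (isHJ-runs signs last)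
    where
    signs : List Bool
    signs = gr ++ replicate (suc n) false ++ true ∷ false ∷ gs
    last : lastOr false signs ≡ true
    last = trans (lastOr-++ false gr (replicate (suc n) false ++ true ∷ false ∷ gs))
                 (trans (lastOr-++ (lastOr false gr) (replicate (suc n) false) (true ∷ false ∷ gs)) gs-last)

module Comparisons where

  open import Data.Bool using (true; false)
  open import Data.Nat
  open import Data.Nat.Properties
  open import Data.Empty using (⊥)
  open import Function using (_∘_)
  open import Relation.Nullary.Reflects using (det; fromEquivalence; ofʸ; ofⁿ)
  open import Relation.Nullary.Decidable using (proof)
  open import Relation.Binary.PropositionalEquality

  private
    variable
      m n p q : ℕ

  <ᵇ-cong : (m < n → p < q) → (p < q → m < n) → (m <ᵇ n) ≡ (p <ᵇ q)
  <ᵇ-cong {m} {n} {p} {q} to from =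
    det (<ᵇ-reflects-< m n) (fromEquivalence (from ∘ <ᵇ⇒< p q) (<⇒<ᵇ ∘ to))

  ≤ᵇ-cong : (m ≤ n → p ≤ q) → (p ≤ q → m ≤ n) → (m ≤ᵇ n) ≡ (p ≤ᵇ q)
  ≤ᵇ-cong {m} {n} {p} {q} to from =
    det (≤ᵇ-reflects-≤ m n) (fromEquivalence (from ∘ ≤ᵇ⇒≤ p q) (≤⇒≤ᵇ ∘ to))

  <⇒<ᵇ≡true : m < n → (m <ᵇ n) ≡ true
  <⇒<ᵇ≡true {m} {n} m<n = det (<ᵇ-reflects-< m n) (ofʸ m<n)

  ≥⇒<ᵇ≡false : n ≤ m → (m <ᵇ n) ≡ false
  ≥⇒<ᵇ≡false {n} {m} n≤m = det (<ᵇ-reflects-< m n) (ofⁿ (≤⇒≯ n≤m))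

  ≤⇒≤ᵇ≡true : m ≤ n → (m ≤ᵇ n) ≡ true
  ≤⇒≤ᵇ≡true {m} {n} m≤n = det (≤ᵇ-reflects-≤ m n) (ofʸ m≤n)

  >⇒≤ᵇ≡false : n < m → (m ≤ᵇ n) ≡ false
  >⇒≤ᵇ≡false {n} {m} n<m = det (≤ᵇ-reflects-≤ m n) (ofⁿ (<⇒≱ n<m))

  -- Certificates for the nonlinear inequalities below: a sum of multiples of the
  -- hypotheses gives S ≤ T, and the ring solver checks T + 1 + K = S.
  infixr 5 _⊕_
  infix 6 _⊛_

  _⊕_ : m ≤ n → p ≤ q → m + p ≤ n + q
  _⊕_ = +-mono-≤

  _⊛_ : ∀ l → m ≤ n → l * m ≤ l * n
  l ⊛ m≤n = *-monoʳ-≤ l m≤n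

  refute : ∀ {S T} K → S ≤ T → T + suc K ≡ S → ⊥
  refute {S} {T} K S≤T T+1+K≡S = <-irrefl refl (begin-strict
    T            <⟨ m<m+n T z<s ⟩
    T + suc K    ≡⟨ T+1+K≡S ⟩
    S            ≤⟨ S≤T ⟩
    T            ∎)
    where open ≤-Reasoning

  ≡ᵇ-cong : (m ≡ n → p ≡ q) → (p ≡ q → m ≡ n) → (m ≡ᵇ n) ≡ (p ≡ᵇ q)
  ≡ᵇ-cong {m} {n} {p} {q} to from =
    det (proof (m ≟ n)) (fromEquivalence (from ∘ ≡ᵇ⇒≡ p q) (≡⇒≡ᵇ p q ∘ to))

  ≡ᵇ-refl : ∀ n → (n ≡ᵇ n) ≡ true
  ≡ᵇ-refl n = det (proof (n ≟ n)) (ofʸ refl)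

  ≢⇒≡ᵇ≡false : m ≢ n → (m ≡ᵇ n) ≡ false
  ≢⇒≡ᵇ≡false {m} {n} m≢n = det (proof (m ≟ n)) (ofⁿ m≢n)

module UnitSquare where

  open Comparisons using (refute; _⊕_; _⊛_)
  open import Data.Nat
  open import Data.Nat.Properties
  open import Data.Nat.Tactic.RingSolver using (solve)
  open import Data.List using ([]; _∷_)
  open import Data.Product using (_×_; _,_)
  open import Data.Empty using (⊥)
  open import Relation.Binary.PropositionalEquality

  InRange : ℕ → ℕ → Pt → Set
  InRange P Q (i , j) = i < Q × j < P

  corner₁₁-inRange : ∀ {P Q i j} → InRange P Q (i , j) → suc i + suc j ≤ P + Q
  corner₁₁-inRange {P} {Q} {i} {j} (i<Q , j<P) = subst (suc i + suc j ≤_) (+-comm Q P) (+-mono-≤ i<Q j<P)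

  corner₁₀-inRange : ∀ {P Q i j} → InRange P Q (i , j) → suc i + j ≤ P + Q
  corner₁₀-inRange {i = i} {j} inRange = ≤-trans (+-monoʳ-≤ (suc i) (n≤1+n j)) (corner₁₁-inRange inRange)

  corner₀₁-inRange : ∀ {P Q i j} → InRange P Q (i , j) → i + suc j ≤ P + Q
  corner₀₁-inRange inRange = ≤-trans (n≤1+n _) (corner₁₁-inRange inRange)

  corner₀₀-inRange : ∀ {P Q i j} → InRange P Q (i , j) → i + j ≤ P + Q
  corner₀₀-inRange inRange = ≤-trans (n≤1+n _) (corner₁₀-inRange inRange)

  -- (i + suc i , suc j + j) is twice the midpoint of the diagonal of the square (i , j).
  diagonal-inRange : ∀ P Q i j → InRange P Q (i , j) → suc ((i + suc i) + (suc j + j)) ≤ P + P + Q + Q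
  diagonal-inRange P Q i j (i<Q , j<P) = ≮⇒≥ cert
    where
    cert : suc (P + P + Q + Q) ≤ suc ((i + suc i) + (suc j + j)) → ⊥
    cert h = refute 1 (h ⊕ 2 ⊛ i<Q ⊕ 2 ⊛ j<P) (solve (P ∷ Q ∷ i ∷ j ∷ []))

  vertical-inRange : ∀ P Q i j → InRange P Q (i , j) → suc ((suc i + suc i) + (j + suc j)) ≤ P + P + Q + Q
  vertical-inRange P Q i j (i<Q , j<P) = ≮⇒≥ cert
    where
    cert : suc (P + P + Q + Q) ≤ suc ((suc i + suc i) + (j + suc j)) → ⊥
    cert h = refute 0 (h ⊕ 2 ⊛ i<Q ⊕ 2 ⊛ j<P) (solve (P ∷ Q ∷ i ∷ j ∷ []))

  horizontal-inRange : ∀ P Q i j → InRange P Q (i , j) → suc ((i + suc i) + (suc j + suc j)) ≤ P + P + Q + Q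
  horizontal-inRange P Q i j (i<Q , j<P) = ≮⇒≥ cert
    where
    cert : suc (P + P + Q + Q) ≤ suc ((i + suc i) + (suc j + suc j)) → ⊥
    cert h = refute 0 (h ⊕ 2 ⊛ i<Q ⊕ 2 ⊛ j<P) (solve (P ∷ Q ∷ i ∷ j ∷ []))

module Squares where

  open UnitSquare using (InRange)
  open Comparisons using (<⇒<ᵇ≡true; ≥⇒<ᵇ≡false)
  open import Data.Bool using (Bool; true; false; if_then_else_; _∧_; T)
  open import Data.Bool.Properties using (∧-zeroʳ)
  open import Data.Nat
  open import Data.Nat.Properties
  open import Data.Nat.Tactic.RingSolver using (solve-∀)
  open import Data.List using (List; []; _∷_; _++_; [_]; concatMap; applyUpTo; upTo)
  open import Data.List.Properties using (++-assoc)
  open import Data.List.Relation.Unary.All using (All; []; _∷_; universal)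
  open import Data.List.Relation.Unary.All.Properties using (concat⁺; map⁺)
  open import Data.Product using (∃; _×_; _,_)
  open import Data.Empty using (⊥-elim)
  open import Relation.Nullary using (yes; no)
  open import Relation.Binary.Definitions using (tri<; tri≈; tri>)
  open import Relation.Binary.PropositionalEquality hiding ([_])

  private
    variable
      A B : Set

  concatMap-applyUpTo-+ : ∀ (f : ℕ → List A) h m n →
    concatMap f (applyUpTo h (m + n)) ≡ concatMap f (applyUpTo h m) ++ concatMap f (applyUpTo (λ i → h (m + i)) n)
  concatMap-applyUpTo-+ f h zero n = refl
  concatMap-applyUpTo-+ f h (suc m) n =
    trans (cong (f (h 0) ++_) (concatMap-applyUpTo-+ f (λ i → h (suc i)) m n)) (sym (++-assoc (f (h 0)) _ _))

  concatMap-applyUpTo-cong : ∀ (f : ℕ → List A) (g : ℕ → List A) h h′ m →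
    (∀ i → i < m → f (h i) ≡ g (h′ i)) → concatMap f (applyUpTo h m) ≡ concatMap g (applyUpTo h′ m)
  concatMap-applyUpTo-cong f g h h′ zero _ = refl
  concatMap-applyUpTo-cong f g h h′ (suc m) eq =
    cong₂ _++_ (eq 0 z<s) (concatMap-applyUpTo-cong f g (λ i → h (suc i)) (λ i → h′ (suc i)) m (λ i i<m → eq (suc i) (s<s i<m)))

  concatMap-applyUpTo-[] : ∀ (f : ℕ → List A) h m → (∀ i → i < m → f (h i) ≡ []) → concatMap f (applyUpTo h m) ≡ []
  concatMap-applyUpTo-[] f h zero _ = refl
  concatMap-applyUpTo-[] f h (suc m) empty =
    cong₂ _++_ (empty 0 z<s) (concatMap-applyUpTo-[] f (λ i → h (suc i)) m (λ i i<m → empty (suc i) (s<s i<m)))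

  squareMet-inRange : ∀ P Q i j → squareMet P Q i j ≡ true → i < Q × j < P
  squareMet-inRange P Q i j met with i <ᵇ Q in i<Q | j <ᵇ P in j<P
  ... | true | true = <ᵇ⇒< i Q (subst T (sym i<Q) _) , <ᵇ⇒< j P (subst T (sym j<P) _)

  squareMet-rightOfRange : ∀ P Q i j → Q ≤ i → squareMet P Q i j ≡ false
  squareMet-rightOfRange P Q i j Q≤i rewrite ≥⇒<ᵇ≡false {Q} {i} Q≤i = refl

  squareMet-aboveRange : ∀ P Q i j → P ≤ j → squareMet P Q i j ≡ false
  squareMet-aboveRange P Q i j P≤j rewrite ≥⇒<ᵇ≡false {P} {j} P≤j = ∧-zeroʳ (i <ᵇ Q)

  cell : ℕ → ℕ → ℕ → ℕ → List Pt
  cell P Q n i = if squareMet P Q i (n ∸ i) then [ (i , n ∸ i) ] else []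

  -- squares P Q lists the met squares diagonal by diagonal; on diagonal n the
  -- square (i , n − i) is found at position i.
  diagonal : ℕ → ℕ → ℕ → List Pt
  diagonal P Q n = concatMap (cell P Q n) (upTo (suc n))

  cell-≡ : ∀ P Q n i j → i + j ≡ n → cell P Q n i ≡ (if squareMet P Q i j then [ (i , j) ] else [])
  cell-≡ P Q n i j refl rewrite m+n∸m≡n i j = refl

  cell-[] : ∀ P Q n i → i ≤ n → (∀ j → i + j ≡ n → squareMet P Q i j ≡ false) → cell P Q n i ≡ []
  cell-[] P Q n i i≤n notMet =
    trans (cell-≡ P Q n i (n ∸ i) (m+[n∸m]≡n i≤n)) (cong (λ met → if met then _ else []) (notMet (n ∸ i) (m+[n∸m]≡n i≤n)))

  diagonal-[] : ∀ P Q n → (∀ i j → i + j ≡ n → squareMet P Q i j ≡ false) → diagonal P Q n ≡ []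
  diagonal-[] P Q n notMet =
    concatMap-applyUpTo-[] (cell P Q n) (λ i → i) (suc n) (λ i i≤n → cell-[] P Q n i (≤-pred i≤n) (notMet i))

  diagonal-single : ∀ P Q n i₀ j₀ → i₀ + j₀ ≡ n → squareMet P Q i₀ j₀ ≡ true →
    (∀ i j → i + j ≡ n → i ≢ i₀ → squareMet P Q i j ≡ false) → diagonal P Q n ≡ [ (i₀ , j₀) ]
  diagonal-single P Q n i₀ j₀ i₀+j₀≡n met notMet = begin
    concatMap (cell P Q n) (upTo (suc n))
      ≡⟨ cong (λ m → concatMap (cell P Q n) (upTo m)) (trans (cong suc (sym i₀+j₀≡n)) (sym (+-suc i₀ j₀))) ⟩
    concatMap (cell P Q n) (applyUpTo (λ i → i) (i₀ + suc j₀))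
      ≡⟨ concatMap-applyUpTo-+ (cell P Q n) (λ i → i) i₀ (suc j₀) ⟩
    concatMap (cell P Q n) (upTo i₀) ++ (cell P Q n (i₀ + 0) ++ concatMap (cell P Q n) (applyUpTo (λ i → i₀ + suc i) j₀))
      ≡⟨ cong₂ (λ u v → u ++ (v ++ concatMap (cell P Q n) (applyUpTo (λ i → i₀ + suc i) j₀))) before at ⟩
    (i₀ , j₀) ∷ concatMap (cell P Q n) (applyUpTo (λ i → i₀ + suc i) j₀)
      ≡⟨ cong ((i₀ , j₀) ∷_) after ⟩
    [ (i₀ , j₀) ] ∎
    where
    open ≡-Reasoning
    empty : ∀ i → i ≤ n → i ≢ i₀ → cell P Q n i ≡ []
    empty i i≤n i≢i₀ = cell-[] P Q n i i≤n (λ j i+j≡n → notMet i j i+j≡n i≢i₀)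
    before : concatMap (cell P Q n) (upTo i₀) ≡ []
    before = concatMap-applyUpTo-[] (cell P Q n) (λ i → i) i₀ (λ i i<i₀ →
      empty i (≤-trans (<⇒≤ i<i₀) (subst (i₀ ≤_) i₀+j₀≡n (m≤m+n i₀ j₀))) (<⇒≢ i<i₀))
    at : cell P Q n (i₀ + 0) ≡ [ (i₀ , j₀) ]
    at = trans (cong (cell P Q n) (+-identityʳ i₀))
               (trans (cell-≡ P Q n i₀ j₀ i₀+j₀≡n) (cong (λ m → if m then _ else []) met))
    after : concatMap (cell P Q n) (applyUpTo (λ i → i₀ + suc i) j₀) ≡ []
    after = concatMap-applyUpTo-[] (cell P Q n) (λ i → i₀ + suc i) j₀ (λ i i<j₀ →
      empty (i₀ + suc i) (subst (i₀ + suc i ≤_) i₀+j₀≡n (+-monoʳ-≤ i₀ i<j₀)) (m+1+n≢m i₀))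

  squares-inRange : ∀ P Q → All (InRange P Q) (squares P Q)
  squares-inRange P Q = concatMap⁺ (λ n → concatMap⁺ (cell-inRange n) (upTo (suc n))) (upTo (P + Q))
    where
    concatMap⁺ : ∀ {X : Set} {f : X → List Pt} → (∀ x → All (InRange P Q) (f x)) → ∀ xs → All (InRange P Q) (concatMap f xs)
    concatMap⁺ all xs = concat⁺ (map⁺ (universal all xs))
    cell-inRange : ∀ n i → All (InRange P Q) (cell P Q n i)
    cell-inRange n i with squareMet P Q i (n ∸ i) in met
    ... | true = squareMet-inRange P Q i (n ∸ i) met ∷ []
    ... | false = []

  squareMet-origin : ∀ p q → squareMet (suc p) (suc q) 0 0 ≡ true
  squareMet-origin p q =
    cong₂ (λ u v → true ∧ true ∧ u ∧ v) (<⇒<ᵇ≡true (positive (suc p) q)) (<⇒<ᵇ≡true (positive (suc q) p))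
    where
    positive : ∀ m n → m * 0 < suc n * 1
    positive m n = subst₂ _<_ (sym (*-zeroʳ m)) (sym (*-identityʳ (suc n))) z<s

  squares-first : ∀ p q → ∃ λ rest → squares (suc p) (suc q) ≡ (0 , 0) ∷ rest
  squares-first p q = _ , cong (λ met → ((if met then [ (0 , 0) ] else []) ++ []) ++ later) (squareMet-origin p q)
    where
    later : List Pt
    later = concatMap (diagonal (suc p) (suc q)) (applyUpTo suc (p + suc q))

  squareMet-end : ∀ p q → squareMet (suc p) (suc q) q p ≡ true
  squareMet-end p q =
    trans (cong₂ (λ u v → u ∧ v ∧ (suc p * q <ᵇ suc q * suc p) ∧ (suc q * p <ᵇ suc p * suc q))
                 (<⇒<ᵇ≡true (n<1+n q)) (<⇒<ᵇ≡true (n<1+n p)))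
          (cong₂ (λ u v → true ∧ true ∧ u ∧ v) (<⇒<ᵇ≡true (below p q)) (<⇒<ᵇ≡true (below q p)))
    where
    below : ∀ m n → suc m * n < suc n * suc m
    below m n = subst (suc m * n <_) (*-comm (suc m) (suc n)) (*-monoʳ-< (suc m) (n<1+n n))

  squares-last : ∀ p q → ∃ λ init → squares (suc p) (suc q) ≡ init ++ [ (q , p) ]
  squares-last p q = concatMap (diagonal P Q) (upTo n) , (begin
    concatMap (diagonal P Q) (upTo (P + Q))                 ≡⟨ cong (λ m → concatMap (diagonal P Q) (upTo m)) P+Q≡n+2 ⟩
    concatMap (diagonal P Q) (applyUpTo (λ i → i) (n + 2))  ≡⟨ concatMap-applyUpTo-+ (diagonal P Q) (λ i → i) n 2 ⟩
    concatMap (diagonal P Q) (upTo n) ++ (diagonal P Q (n + 0) ++ (diagonal P Q (n + 1) ++ []))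
      ≡⟨ cong₂ (λ u v → concatMap (diagonal P Q) (upTo n) ++ (u ++ (v ++ []))) lastDiagonal beyond ⟩
    concatMap (diagonal P Q) (upTo n) ++ [ (q , p) ]        ∎)
    where
    open ≡-Reasoning
    P Q n : ℕ
    P = suc p
    Q = suc q
    n = q + p
    P+Q≡n+2 : suc p + suc q ≡ q + p + 2
    P+Q≡n+2 = identity p q
      where
      identity : ∀ p q → suc p + suc q ≡ q + p + 2
      identity = solve-∀
    lastDiagonal : diagonal P Q (n + 0) ≡ [ (q , p) ]
    lastDiagonal = trans (cong (diagonal P Q) (+-identityʳ n)) (diagonal-single P Q n q p refl (squareMet-end p q) notMet)
      where
      notMet : ∀ i j → i + j ≡ n → i ≢ q → squareMet P Q i j ≡ false
      notMet i j i+j≡n i≢q with <-cmp i q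
      ... | tri< i<q _ _ = squareMet-aboveRange P Q i j (≰⇒> λ j≤p → <-irrefl refl (subst (_< q + p) i+j≡n (+-mono-<-≤ i<q j≤p)))
      ... | tri≈ _ i≡q _ = ⊥-elim (i≢q i≡q)
      ... | tri> _ _ q<i = squareMet-rightOfRange P Q i j q<i
    beyond : diagonal P Q (n + 1) ≡ []
    beyond = diagonal-[] P Q (n + 1) notMet
      where
      notMet : ∀ i j → i + j ≡ n + 1 → squareMet P Q i j ≡ false
      notMet i j i+j≡n+1 with i ≤? q
      ... | yes i≤q = squareMet-aboveRange P Q i j (≰⇒> λ j≤p →
                        <-irrefl refl (subst (_≤ q + p) (trans i+j≡n+1 (+-comm n 1)) (+-mono-≤ i≤q j≤p)))
      ... | no i≰q = squareMet-rightOfRange P Q i j (≰⇒> i≰q)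

module Items where

  open Comparisons using (≡ᵇ-cong)
  open import Data.Bool using (true; false)
  open import Data.Nat using (ℕ; suc; _+_; _≡ᵇ_)
  open import Data.Nat.Properties using (+-cancelʳ-≡)
  open import Data.List using (List; []; _∷_; _++_; [_]; map)
  open import Data.List.Properties using (++-assoc; ++-identityʳ; map-++)
  open import Data.List.Relation.Unary.All using (All; []; _∷_)
  open import Data.List.Relation.Unary.All.Properties using (++⁺)
  open import Data.Product using (∃; _,_)
  open import Relation.Binary.PropositionalEquality hiding ([_])

  upperTri : Pt → Item
  upperTri (i , j) = tri (suc i , suc j) (suc i , j) (i , suc j)

  items-++ : ∀ l p q m → items (l ++ p ∷ q ∷ m) ≡ items (l ++ [ p ]) ++ commonSide p q ∷ items (q ∷ m)
  items-++ [] p q m = refl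
  items-++ (x ∷ []) p q m = sym (++-assoc (squareItems x) (commonSide x p ∷ squareItems p) _)
  items-++ (x ∷ y ∷ l) p q m =
    trans (cong (λ is → squareItems x ++ commonSide x y ∷ is) (items-++ (y ∷ l) p q m))
          (sym (++-assoc (squareItems x) (commonSide x y ∷ items (y ∷ l ++ [ p ])) _))

  items-∷ : ∀ p l → ∃ λ rest → items (p ∷ l) ≡ squareItems p ++ rest
  items-∷ p [] = [] , sym (++-identityʳ (squareItems p))
  items-∷ p (q ∷ l) = _ , refl

  items-∷ʳ : ∀ l x → ∃ λ init → items (l ++ [ x ]) ≡ init ++ [ upperTri x ]
  items-∷ʳ [] (i , j) = _ ∷ _ ∷ [] , refl
  items-∷ʳ (y ∷ []) x =
    squareItems y ++ commonSide y x ∷ _ ∷ _ ∷ [] , sym (++-assoc (squareItems y) (commonSide y x ∷ _ ∷ _ ∷ []) [ upperTri x ])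
  items-∷ʳ (y ∷ z ∷ l) x with items-∷ʳ (z ∷ l) x
  ... | init , eq =
    squareItems y ++ commonSide y z ∷ init ,
    trans (cong (λ is → squareItems y ++ commonSide y z ∷ is) eq) (sym (++-assoc (squareItems y) (commonSide y z ∷ init) _))

  items-All : ∀ {S : Pt → Set} {R : Item → Set} l → All S l →
    (∀ s → S s → All R (squareItems s)) → (∀ p q → S p → R (commonSide p q)) → All R (items l)
  items-All [] [] _ _ = []
  items-All (x ∷ []) (sx ∷ []) inSquare _ = inSquare x sx
  items-All (x ∷ y ∷ l) (sx ∷ sl) inSquare onSide = ++⁺ (inSquare x sx) (onSide x y sx ∷ items-All (y ∷ l) sl inSquare onSide)

  module Translation (u v : ℕ) where

    translate : Pt → Pt
    translate (i , j) = (i + u , j + v)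

    translateItem : Item → Item
    translateItem (tri p q r) = tri (translate p) (translate q) (translate r)
    translateItem (edge p q) = edge (translate p) (translate q)

    commonSide-translate : ∀ p q → commonSide (translate p) (translate q) ≡ translateItem (commonSide p q)
    commonSide-translate (i , j) (i′ , j′)
      rewrite ≡ᵇ-cong {i′ + u} {suc i + u} {i′} {suc i} (+-cancelʳ-≡ u i′ (suc i)) (cong (_+ u)) with i′ ≡ᵇ suc i
    ... | true = refl
    ... | false = refl

    items-translate : ∀ l → items (map translate l) ≡ map translateItem (items l)
    items-translate [] = refl
    items-translate (x ∷ []) = refl
    items-translate (x ∷ y ∷ l) =
      trans (cong₂ (λ side is → squareItems (translate x) ++ side ∷ is) (commonSide-translate x y) (items-translate (y ∷ l)))
            (sym (map-++ translateItem (squareItems x) (commonSide x y ∷ items (y ∷ l))))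

  commonSide-elim : ∀ {R : Item → Set} i j q →
    R (edge (suc i , j) (suc i , suc j)) → R (edge (i , suc j) (suc i , suc j)) → R (commonSide (i , j) q)
  commonSide-elim i j (i′ , j′) vertical horizontal with i′ ≡ᵇ suc i
  ... | true = vertical
  ... | false = horizontal

module EndSigns where

  open Comparisons using (<⇒<ᵇ≡true; ≥⇒<ᵇ≡false)
  open Squares using (squares-first; squares-last)
  open Items using (upperTri; items-∷; items-∷ʳ)
  open SignRuns using (lastOr; lastOr-++)
  open import Data.Bool using (Bool; true; false; not)
  open import Data.Nat using (suc; _+_; _*_; _<_; _≡ᵇ_)
  open import Data.Nat.Properties using (*-comm; *-monoʳ-≤; *-monoʳ-<; n≤1+n; n<1+n; ≤-reflexive; ≤-trans)
  open import Data.List using (List; []; _∷_; _++_; [_]; concatMap)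
  open import Data.List.Properties using (∷-injective; concatMap-++)
  open import Data.Product using (∃; _,_; proj₁; proj₂)
  open import Data.Empty using (⊥-elim)
  open import Relation.Binary.PropositionalEquality hiding ([_])

  lowerTri₀ : Item
  lowerTri₀ = tri (0 , 0) (1 , 0) (0 , 1)

  items-squares : ∀ p q → ∃ λ rest → items (squares (suc p) (suc q)) ≡ squareItems (0 , 0) ++ rest
  items-squares p q with squares-first p q
  ... | squares′ , eq with items-∷ (0 , 0) squares′
  ...   | rest , eq′ = rest , trans (cong items eq) eq′

  -- The sign of a triangle only depends on which of its vertices lie strictly above the line.
  triangleSign-cong : ∀ {u v w u′ v′ w′} → u ≡ u′ → v ≡ v′ → w ≡ w′ →
    [ not (count u + count v + count w ≡ᵇ 2) ] ≡ [ not (count u′ + count v′ + count w′ ≡ᵇ 2) ]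
  triangleSign-cong refl refl refl = refl

  upperTri-sign : ∀ fc k p q → itemSigns fc k (suc p) (suc q) (upperTri (q , p)) ≡ [ true ]
  upperTri-sign fc k p q = triangleSign-cong (≥⇒<ᵇ≡false (≤-reflexive (*-comm (suc q) (suc p))))
                                        (≥⇒<ᵇ≡false (≤-trans (*-monoʳ-≤ (suc q) (n≤1+n p)) (≤-reflexive (*-comm (suc q) (suc p)))))
                                        (<⇒<ᵇ≡true (subst (suc p * q <_) (*-comm (suc p) (suc q)) (*-monoʳ-< (suc p) (n<1+n q))))

  private
    lastOr-concatMap-∷ʳ : ∀ (f : Item → List Bool) xs x c → f x ≡ [ true ] → lastOr c (concatMap f (xs ++ [ x ])) ≡ true
    lastOr-concatMap-∷ʳ f xs x c fx≡+ = begin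
      lastOr c (concatMap f (xs ++ [ x ]))                 ≡⟨ cong (lastOr c) (concatMap-++ f xs [ x ]) ⟩
      lastOr c (concatMap f xs ++ (f x ++ []))             ≡⟨ lastOr-++ c (concatMap f xs) (f x ++ []) ⟩
      lastOr (lastOr c (concatMap f xs)) (f x ++ [])       ≡⟨ cong (λ signs → lastOr (lastOr c (concatMap f xs)) (signs ++ [])) fx≡+ ⟩
      true                                                 ∎
      where open ≡-Reasoning

    tail-∷ʳ : ∀ p q rest init → lowerTri₀ ∷ rest ≡ init ++ [ upperTri (q , p) ] → ∃ λ init′ → rest ≡ init′ ++ [ upperTri (q , p) ]
    tail-∷ʳ p q rest [] eq = ⊥-elim (lowerTri₀≢upperTri (proj₁ (∷-injective eq)))
      where
      lowerTri₀≢upperTri : lowerTri₀ ≢ upperTri (q , p)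
      lowerTri₀≢upperTri ()
    tail-∷ʳ p q rest (_ ∷ init′) eq = init′ , proj₂ (∷-injective eq)

  -- The last item met by L_t is the upper triangle of the last square, whose sign is +.
  signs-last : ∀ fc k p q rest → items (squares (suc p) (suc q)) ≡ lowerTri₀ ∷ rest →
    lastOr false (concatMap (itemSigns fc k (suc p) (suc q)) rest) ≡ true
  signs-last fc k p q rest eq with squares-last p q
  ... | init , eq′ with items-∷ʳ init (q , p)
  ...   | init′ , eq″ with tail-∷ʳ p q rest init′ (trans (sym eq) (trans (cong items eq′) eq″))
  ...     | init″ , rest≡ = trans (cong (λ is → lastOr false (concatMap (itemSigns fc k (suc p) (suc q)) is)) rest≡)
                                  (lastOr-concatMap-∷ʳ (itemSigns fc k (suc p) (suc q)) init″ (upperTri (q , p)) false (upperTri-sign fc k p q))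

module Centre where

  open Comparisons using (≤⇒≤ᵇ≡true)
  open import Data.Bool using (Bool; true; _∧_; _∨_)
  open import Data.Bool.Properties using (∨-zeroʳ; T-≡; T-∨; T-∧)
  open import Function.Bundles using (Equivalence)
  open import Data.Nat as ℕ using (ℕ; suc; _≤_; _≤ᵇ_)
  open import Data.Nat.Properties as ℕ using (≤-antisym; m≤n⇒m<n∨m≡n; +-suc; +-cancelʳ-≡; ≤-total; ≤ᵇ⇒≤)
  open import Data.Nat.Tactic.RingSolver as ℕ-Solver using ()
  open import Data.Product using (_×_; _,_; proj₁; proj₂)
  open import Data.Sum using (_⊎_; inj₁; inj₂)
  open import Data.Empty using (⊥; ⊥-elim)
  open import Relation.Nullary using (Dec; yes; no)
  open import Relation.Binary.PropositionalEquality
  import Data.Integer as ℤ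
  open ℤ using (ℤ; +_; 1ℤ)
  import Data.Integer.Properties as ℤ
  open import Data.Integer.Tactic.RingSolver using (solve-∀)

  NotBothEven : ℕ → ℕ → Set
  NotBothEven P Q = ∀ u v → P ≡ u ℕ.+ u → Q ≡ v ℕ.+ v → ⊥

  -- Mirrors the function between local to containsCentre.
  private
    between : ℕ → ℕ → ℕ → Bool
    between u v w = ((u ≤ᵇ v) ∧ (v ≤ᵇ w)) ∨ ((w ≤ᵇ v) ∧ (v ≤ᵇ u))

    2ℤ : ℤ
    2ℤ = + 2

  Collinear : (P Q : ℕ) → Pt → Pt → Set
  Collinear P Q (x₁ , y₁) (x₂ , y₂) =
    (+ (2 ℕ.* x₂) ℤ.- + (2 ℕ.* x₁)) ℤ.* (+ P ℤ.- + (2 ℕ.* y₁))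
      ≡ (+ (2 ℕ.* y₂) ℤ.- + (2 ℕ.* y₁)) ℤ.* (+ Q ℤ.- + (2 ℕ.* x₁))

  collinear? : ∀ P Q x₁ y₁ x₂ y₂ → Dec (Collinear P Q (x₁ , y₁) (x₂ , y₂))
  collinear? P Q x₁ y₁ x₂ y₂ =
    (+ (2 ℕ.* x₂) ℤ.- + (2 ℕ.* x₁)) ℤ.* (+ P ℤ.- + (2 ℕ.* y₁))
      ℤ.≟ (+ (2 ℕ.* y₂) ℤ.- + (2 ℕ.* y₁)) ℤ.* (+ Q ℤ.- + (2 ℕ.* x₁))

  containsCentre-collinear : ∀ P Q x₁ y₁ x₂ y₂ → Collinear P Q (x₁ , y₁) (x₂ , y₂) →
    containsCentre P Q (x₁ , y₁) (x₂ , y₂) ≡ between (2 ℕ.* x₁) Q (2 ℕ.* x₂) ∧ between (2 ℕ.* y₁) P (2 ℕ.* y₂)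
  containsCentre-collinear P Q x₁ y₁ x₂ y₂ col
    with collinear? P Q x₁ y₁ x₂ y₂
  ... | yes _ = refl
  ... | no ¬col = ⊥-elim (¬col col)

  containsCentre-true : ∀ P Q x₁ y₁ x₂ y₂ → containsCentre P Q (x₁ , y₁) (x₂ , y₂) ≡ true →
    Collinear P Q (x₁ , y₁) (x₂ , y₂) × between (2 ℕ.* x₁) Q (2 ℕ.* x₂) ≡ true × between (2 ℕ.* y₁) P (2 ℕ.* y₂) ≡ true
  containsCentre-true P Q x₁ y₁ x₂ y₂ cc
    with collinear? P Q x₁ y₁ x₂ y₂
  ... | yes col = col , ∧-true cc
    where
    ∧-true : ∀ {u v} → u ∧ v ≡ true → u ≡ true × v ≡ true
    ∧-true {true} {true} _ = refl , refl

  containsCentre-midpoint : ∀ x₁ y₁ x₂ y₂ → containsCentre (y₁ ℕ.+ y₂) (x₁ ℕ.+ x₂) (x₁ , y₁) (x₂ , y₂) ≡ true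
  containsCentre-midpoint x₁ y₁ x₂ y₂ =
    trans (containsCentre-collinear (y₁ ℕ.+ y₂) (x₁ ℕ.+ x₂) x₁ y₁ x₂ y₂ col)
          (cong₂ _∧_ (between-midpoint x₁ x₂) (between-midpoint y₁ y₂))
    where
    double : ∀ n → + (2 ℕ.* n) ≡ 2ℤ ℤ.* + n
    double = ℤ.pos-* 2
    identity : ∀ X₁ Y₁ X₂ Y₂ → (2ℤ ℤ.* X₂ ℤ.- 2ℤ ℤ.* X₁) ℤ.* ((Y₁ ℤ.+ Y₂) ℤ.- 2ℤ ℤ.* Y₁)
                              ≡ (2ℤ ℤ.* Y₂ ℤ.- 2ℤ ℤ.* Y₁) ℤ.* ((X₁ ℤ.+ X₂) ℤ.- 2ℤ ℤ.* X₁)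
    identity = solve-∀
    col : Collinear (y₁ ℕ.+ y₂) (x₁ ℕ.+ x₂) (x₁ , y₁) (x₂ , y₂)
    col rewrite double x₁ | double x₂ | double y₁ | double y₂ | ℤ.pos-+ x₁ x₂ | ℤ.pos-+ y₁ y₂ =
      identity (+ x₁) (+ y₁) (+ x₂) (+ y₂)
    n+n : ∀ n → 2 ℕ.* n ≡ n ℕ.+ n
    n+n n = cong (n ℕ.+_) (ℕ.+-identityʳ n)
    between-midpoint : ∀ u w → between (2 ℕ.* u) (u ℕ.+ w) (2 ℕ.* w) ≡ true
    between-midpoint u w with ≤-total u w
    ... | inj₁ u≤w rewrite n+n u | n+n w
        | ≤⇒≤ᵇ≡true (ℕ.+-monoʳ-≤ u u≤w) | ≤⇒≤ᵇ≡true (ℕ.+-monoˡ-≤ w u≤w) = refl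
    ... | inj₂ w≤u rewrite n+n u | n+n w
        | ≤⇒≤ᵇ≡true (ℕ.+-monoˡ-≤ w w≤u) | ≤⇒≤ᵇ≡true (ℕ.+-monoʳ-≤ u w≤u) = ∨-zeroʳ _

  private
    open Equivalence

    between-true : ∀ u v w → between u v w ≡ true → (u ≤ v × v ≤ w) ⊎ (w ≤ v × v ≤ u)
    between-true u v w eq with to T-∨ (from T-≡ eq)
    ... | inj₁ t = inj₁ (≤ᵇ⇒≤ u v (proj₁ (to T-∧ t)) , ≤ᵇ⇒≤ v w (proj₂ (to T-∧ t)))
    ... | inj₂ t = inj₂ (≤ᵇ⇒≤ w v (proj₁ (to T-∧ t)) , ≤ᵇ⇒≤ v u (proj₂ (to T-∧ t)))

    2*n≡n+n : ∀ n → 2 ℕ.* n ≡ n ℕ.+ n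
    2*n≡n+n n = cong (n ℕ.+_) (ℕ.+-identityʳ n)

    2*suc : ∀ n → 2 ℕ.* suc n ≡ suc (suc (n ℕ.+ n))
    2*suc n = trans (2*n≡n+n (suc n)) (cong suc (+-suc n n))

    DoubledUnit : ℕ → ℕ → Set
    DoubledUnit n v = v ≡ n ℕ.+ n ⊎ v ≡ suc (n ℕ.+ n) ⊎ v ≡ suc (suc (n ℕ.+ n))

    doubledUnit : ∀ n v → n ℕ.+ n ≤ v → v ≤ suc (suc (n ℕ.+ n)) → DoubledUnit n v
    doubledUnit n v lo hi with m≤n⇒m<n∨m≡n lo
    ... | inj₂ eq = inj₁ (sym eq)
    ... | inj₁ lo′ with m≤n⇒m<n∨m≡n lo′
    ...   | inj₂ eq = inj₂ (inj₁ (sym eq))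
    ...   | inj₁ lo″ = inj₂ (inj₂ (≤-antisym hi lo″))

    between-unit : ∀ n v → between (2 ℕ.* n) v (2 ℕ.* suc n) ≡ true → DoubledUnit n v
    between-unit n v bt with between-true (2 ℕ.* n) v (2 ℕ.* suc n) bt
    ... | inj₁ (lo , hi) = doubledUnit n v (subst (_≤ v) (2*n≡n+n n) lo) (subst (v ≤_) (2*suc n) hi)
    ... | inj₂ (hi , lo) = ⊥-elim (ℕ.<⇒≱ (ℕ.*-monoʳ-< 2 (ℕ.n<1+n n)) (ℕ.≤-trans hi lo))

    between-point : ∀ n v → between (2 ℕ.* n) v (2 ℕ.* n) ≡ true → v ≡ n ℕ.+ n
    between-point n v bt with between-true (2 ℕ.* n) v (2 ℕ.* n) bt
    ... | inj₁ (lo , hi) = trans (≤-antisym hi lo) (2*n≡n+n n)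
    ... | inj₂ (lo , hi) = trans (≤-antisym hi lo) (2*n≡n+n n)

    diagonal-sum : ∀ P Q i j → Collinear P Q (i , suc j) (suc i , j) → P ℕ.+ Q ≡ i ℕ.+ i ℕ.+ (j ℕ.+ j) ℕ.+ 2
    diagonal-sum P Q i j col = ℤ.+-injective (begin
      + P ℤ.+ + Q                                     ≡⟨ regroup (+ P) (+ Q) (+ j) ⟩
      (+ P ℤ.- 2ℤ ℤ.* + j ℤ.- 2ℤ) ℤ.+ (+ Q ℤ.+ 2ℤ ℤ.* + j ℤ.+ 2ℤ) ≡⟨ cong (ℤ._+ (+ Q ℤ.+ 2ℤ ℤ.* + j ℤ.+ 2ℤ)) halved ⟩
      (2ℤ ℤ.* + i ℤ.- + Q) ℤ.+ (+ Q ℤ.+ 2ℤ ℤ.* + j ℤ.+ 2ℤ) ≡⟨ collect (+ Q) (+ i) (+ j) ⟩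
      (+ i ℤ.+ + i) ℤ.+ (+ j ℤ.+ + j) ℤ.+ 2ℤ          ∎)
      where
      open ≡-Reasoning
      double : ∀ n → + (2 ℕ.* n) ≡ 2ℤ ℤ.* + n
      double = ℤ.pos-* 2
      col′ : (2ℤ ℤ.* (1ℤ ℤ.+ + i) ℤ.- 2ℤ ℤ.* + i) ℤ.* (+ P ℤ.- 2ℤ ℤ.* (1ℤ ℤ.+ + j))
             ≡ (2ℤ ℤ.* + j ℤ.- 2ℤ ℤ.* (1ℤ ℤ.+ + j)) ℤ.* (+ Q ℤ.- 2ℤ ℤ.* + i)
      col′ rewrite sym (double (suc i)) | sym (double i) | sym (double (suc j)) | sym (double j) = col
      lhs : ∀ p i j → (2ℤ ℤ.* (1ℤ ℤ.+ i) ℤ.- 2ℤ ℤ.* i) ℤ.* (p ℤ.- 2ℤ ℤ.* (1ℤ ℤ.+ j)) ≡ 2ℤ ℤ.* (p ℤ.- 2ℤ ℤ.* j ℤ.- 2ℤ)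
      lhs = solve-∀
      rhs : ∀ q i j → (2ℤ ℤ.* j ℤ.- 2ℤ ℤ.* (1ℤ ℤ.+ j)) ℤ.* (q ℤ.- 2ℤ ℤ.* i) ≡ 2ℤ ℤ.* (2ℤ ℤ.* i ℤ.- q)
      rhs = solve-∀
      regroup : ∀ p q j → p ℤ.+ q ≡ (p ℤ.- 2ℤ ℤ.* j ℤ.- 2ℤ) ℤ.+ (q ℤ.+ 2ℤ ℤ.* j ℤ.+ 2ℤ)
      regroup = solve-∀
      collect : ∀ q i j → (2ℤ ℤ.* i ℤ.- q) ℤ.+ (q ℤ.+ 2ℤ ℤ.* j ℤ.+ 2ℤ) ≡ (i ℤ.+ i) ℤ.+ (j ℤ.+ j) ℤ.+ 2ℤ
      collect = solve-∀
      halved : + P ℤ.- 2ℤ ℤ.* + j ℤ.- 2ℤ ≡ 2ℤ ℤ.* + i ℤ.- + Q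
      halved = ℤ.*-cancelˡ-≡ 2ℤ _ _ (trans (sym (lhs (+ P) (+ i) (+ j))) (trans col′ (rhs (+ Q) (+ i) (+ j))))

    P-from : ∀ P Q i j → Collinear P Q (i , suc j) (suc i , j) → ∀ X → X ℕ.+ Q ≡ i ℕ.+ i ℕ.+ (j ℕ.+ j) ℕ.+ 2 → P ≡ X
    P-from P Q i j col X X+Q≡ = +-cancelʳ-≡ Q P X (trans (diagonal-sum P Q i j col) (sym X+Q≡))

    even₀ : ∀ i j → suc j ℕ.+ suc j ℕ.+ (i ℕ.+ i) ≡ i ℕ.+ i ℕ.+ (j ℕ.+ j) ℕ.+ 2
    even₀ = ℕ-Solver.solve-∀

    odd : ∀ i j → suc j ℕ.+ j ℕ.+ suc (i ℕ.+ i) ≡ i ℕ.+ i ℕ.+ (j ℕ.+ j) ℕ.+ 2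
    odd = ℕ-Solver.solve-∀

    even₂ : ∀ i j → j ℕ.+ j ℕ.+ suc (suc (i ℕ.+ i)) ≡ i ℕ.+ i ℕ.+ (j ℕ.+ j) ℕ.+ 2
    even₂ = ℕ-Solver.solve-∀


  -- The centre (Q/2 , P/2) can lie on a unit edge only at the edge's midpoint.
  vertical-containsCentre : ∀ P Q i j → NotBothEven P Q → containsCentre P Q (suc i , j) (suc i , suc j) ≡ true →
    (suc i ℕ.+ suc i ≡ Q) × (j ℕ.+ suc j ≡ P)
  vertical-containsCentre P Q i j nbe cc with containsCentre-true P Q (suc i) j (suc i) (suc j) cc
  ... | _ , btˣ , btʸ with between-point (suc i) Q btˣ | between-unit j P btʸ
  ...   | Q≡ | inj₁ P≡          = ⊥-elim (nbe j (suc i) P≡ Q≡)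
  ...   | Q≡ | inj₂ (inj₁ P≡)   = sym Q≡ , trans (+-suc j j) (sym P≡)
  ...   | Q≡ | inj₂ (inj₂ P≡)   = ⊥-elim (nbe (suc j) (suc i) (trans P≡ (cong suc (sym (+-suc j j)))) Q≡)

  horizontal-containsCentre : ∀ P Q i j → NotBothEven P Q → containsCentre P Q (i , suc j) (suc i , suc j) ≡ true →
    (i ℕ.+ suc i ≡ Q) × (suc j ℕ.+ suc j ≡ P)
  horizontal-containsCentre P Q i j nbe cc with containsCentre-true P Q i (suc j) (suc i) (suc j) cc
  ... | _ , btˣ , btʸ with between-unit i Q btˣ | between-point (suc j) P btʸ
  ...   | inj₁ Q≡        | P≡ = ⊥-elim (nbe (suc j) i P≡ Q≡)
  ...   | inj₂ (inj₁ Q≡) | P≡ = trans (+-suc i i) (sym Q≡) , sym P≡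
  ...   | inj₂ (inj₂ Q≡) | P≡ = ⊥-elim (nbe (suc j) (suc i) P≡ (trans Q≡ (cong suc (sym (+-suc i i)))))

  diagonal-containsCentre : ∀ P Q i j → NotBothEven P Q → containsCentre P Q (i , suc j) (suc i , j) ≡ true →
    (i ℕ.+ suc i ≡ Q) × (suc j ℕ.+ j ≡ P)
  diagonal-containsCentre P Q i j nbe cc with containsCentre-true P Q i (suc j) (suc i) j cc
  ... | col , btˣ , _ with between-unit i Q btˣ
  ...   | inj₁ Q≡ =
    ⊥-elim (nbe (suc j) i (P-from P Q i j col _ (subst (λ q → suc j ℕ.+ suc j ℕ.+ q ≡ _) (sym Q≡) (even₀ i j))) Q≡)
  ...   | inj₂ (inj₁ Q≡) =
    trans (+-suc i i) (sym Q≡) , sym (P-from P Q i j col _ (subst (λ q → suc j ℕ.+ j ℕ.+ q ≡ _) (sym Q≡) (odd i j)))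
  ...   | inj₂ (inj₂ Q≡) =
    ⊥-elim (nbe j (suc i) (P-from P Q i j col _ (subst (λ q → j ℕ.+ j ℕ.+ q ≡ _) (sym Q≡) (even₂ i j)))
                          (trans Q≡ (cong suc (sym (+-suc i i)))))

open import Data.Nat using (ℕ; suc; _+_; _*_; _≤_; _<_)
open import Relation.Binary.PropositionalEquality using (_≡_)

module Neighbours (a b c d : ℕ) (det : b * c ≡ a * d + 1)
                  (1≤a : 1 ≤ a) (1≤b : 1 ≤ b) (1≤c : 1 ≤ c) (c<d : c < d) where

  open import Data.Nat
  open Comparisons
  open import Data.Bool using (Bool; true; false; _∧_; T)
  open import Data.Bool.Properties using (∧-zeroʳ; T-∧)
  open import Data.Nat.Properties
  open import Data.Nat.Tactic.RingSolver using (solve)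
  open import Data.List using (_∷_; [])
  open import Data.Product using (_×_; _,_; proj₁; proj₂)
  open import Data.Sum using (inj₁; inj₂)
  open import Data.Empty using (⊥; ⊥-elim)
  open import Function.Bundles using (Equivalence)
  open import Relation.Nullary using (¬_)
  open import Relation.Binary.PropositionalEquality

  private
    1≤d : 1 ≤ d
    1≤d = ≤-trans (s≤s z≤n) c<d

    det≤ : b * c ≤ a * d + 1
    det≤ = ≤-reflexive det

    det≥ : a * d + 1 ≤ b * c
    det≥ = ≤-reflexive (sym det)

    ∧-cong-under : ∀ {x x′ y y′} z → (T z → x ≡ x′) → (T z → y ≡ y′) → x ∧ y ∧ z ≡ x′ ∧ y′ ∧ z
    ∧-cong-under {x} {x′} {y} {y′} false _ _ =
      trans (trans (cong (x ∧_) (∧-zeroʳ y)) (∧-zeroʳ x)) (sym (trans (cong (x′ ∧_) (∧-zeroʳ y′)) (∧-zeroʳ x′)))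
    ∧-cong-under true x≡x′ y≡y′ = cong₂ (λ u v → u ∧ v ∧ true) (x≡x′ _) (y≡y′ _)

    T-<ᵇ : ∀ {m n} → T (m <ᵇ n) → m < n
    T-<ᵇ {m} {n} = <ᵇ⇒< m n

    squareMet-false₄ : ∀ P Q i j → (Q * j <ᵇ P * suc i) ≡ false → squareMet P Q i j ≡ false
    squareMet-false₄ P Q i j e rewrite e =
      trans (cong (λ u → (i <ᵇ Q) ∧ u) (trans (cong ((j <ᵇ P) ∧_) (∧-zeroʳ _)) (∧-zeroʳ _))) (∧-zeroʳ _)

    squareMet-false₃ : ∀ P Q i j → (P * i <ᵇ Q * suc j) ≡ false → squareMet P Q i j ≡ false
    squareMet-false₃ P Q i j e rewrite e = trans (cong ((i <ᵇ Q) ∧_) (∧-zeroʳ _)) (∧-zeroʳ _)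

  strictlyAbove-r : ∀ x y → x + y ≤ a + b → strictlyAbove (a + c) (b + d) (x , y) ≡ strictlyAbove a b (x , y)
  strictlyAbove-r x y reg = <ᵇ-cong (λ t → ≰⇒> (tAbove⇒rAbove t)) (λ r → ≰⇒> (rAbove⇒tAbove r))
    where
    tAbove⇒rAbove : (a + c) * x < (b + d) * y → b * y ≤ a * x → ⊥
    tAbove⇒rAbove t r = refute x ((b + d) ⊛ r ⊕ b ⊛ t ⊕ x ⊛ det≥ ⊕ 1≤b) (solve (a ∷ b ∷ c ∷ d ∷ x ∷ y ∷ []))
    rAbove⇒tAbove : a * x < b * y → (b + d) * y ≤ (a + c) * x → ⊥
    rAbove⇒tAbove r t =
      refute d ((a + b + c + d) ⊛ r ⊕ (a + b) ⊛ t ⊕ reg ⊕ 1≤c ⊕ (x + y) ⊛ det≤) (solve (a ∷ b ∷ c ∷ d ∷ x ∷ y ∷ []))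

  strictlyBelow-r : ∀ x y → suc (x + y) ≤ a + b → ((b + d) * y <ᵇ (a + c) * x) ≡ (b * y <ᵇ a * x)
  strictlyBelow-r x y reg = <ᵇ-cong (λ t → ≰⇒> (tBelow⇒rBelow t)) (λ r → ≰⇒> (rBelow⇒tBelow r))
    where
    tBelow⇒rBelow : (b + d) * y < (a + c) * x → a * x ≤ b * y → ⊥
    tBelow⇒rBelow t r =
      refute 0 ((a + b + c + d) ⊛ r ⊕ (a + b) ⊛ t ⊕ reg ⊕ (x + y) ⊛ det≤) (solve (a ∷ b ∷ c ∷ d ∷ x ∷ y ∷ []))
    rBelow⇒tBelow : b * y < a * x → (a + c) * x ≤ (b + d) * y → ⊥
    rBelow⇒tBelow r t = refute (y + a) ((a + c) ⊛ r ⊕ a ⊛ t ⊕ y ⊛ det≥ ⊕ 1≤c) (solve (a ∷ b ∷ c ∷ d ∷ x ∷ y ∷ []))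

  private
    midOnOrAbove-r′ : ∀ X Y → suc (X + Y) ≤ a + a + b + b → ¬ (X ≡ b × Y ≡ a) →
      ((a + c) * X ≤ᵇ (b + d) * Y) ≡ (a * X ≤ᵇ b * Y)
    midOnOrAbove-r′ X Y reg ¬centre = ≤ᵇ-cong (λ t → ≮⇒≥ (λ r → tOnAbove⇒rOnAbove r t)) (λ r → ≮⇒≥ (rOnAbove⇒tOnAbove r))
      where
      tOnAbove⇒rOnAbove : b * Y < a * X → (a + c) * X ≤ (b + d) * Y → ⊥
      tOnAbove⇒rOnAbove r t = refute (Y + a) ((a + c) ⊛ r ⊕ a ⊛ t ⊕ Y ⊛ det≥ ⊕ 1≤c) (solve (a ∷ b ∷ c ∷ d ∷ X ∷ Y ∷ []))
      below : a * X < b * Y → (b + d) * Y < (a + c) * X → ⊥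
      below r t = refute (c + d) ((a + b + c + d) ⊛ r ⊕ (a + b) ⊛ t ⊕ reg ⊕ (X + Y) ⊛ det≤) (solve (a ∷ b ∷ c ∷ d ∷ X ∷ Y ∷ []))
      -- a X = b Y forces (X , Y) = m (b , a) with m = c X − d Y, and m ≥ 2 is out of range
      onLine : a * X ≡ b * Y → (b + d) * Y < (a + c) * X → X ≡ b × Y ≡ a
      onLine aX≡bY t = multiple (c * X ∸ d * Y) X≡bm Y≡am
        where
        open ≡-Reasoning
        b[cX]≡b[dY]+X : b * (c * X) ≡ b * (d * Y) + X
        b[cX]≡b[dY]+X = begin
          b * (c * X)       ≡⟨ *-assoc b c X ⟨
          (b * c) * X       ≡⟨ cong (_* X) det ⟩
          (a * d + 1) * X   ≡⟨ solve (a ∷ d ∷ X ∷ []) ⟩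
          d * (a * X) + X   ≡⟨ cong (λ v → d * v + X) aX≡bY ⟩
          d * (b * Y) + X   ≡⟨ solve (b ∷ d ∷ Y ∷ X ∷ []) ⟩
          b * (d * Y) + X   ∎
        a[cX]≡a[dY]+Y : a * (c * X) ≡ a * (d * Y) + Y
        a[cX]≡a[dY]+Y = begin
          a * (c * X)       ≡⟨ solve (a ∷ c ∷ X ∷ []) ⟩
          c * (a * X)       ≡⟨ cong (c *_) aX≡bY ⟩
          c * (b * Y)       ≡⟨ solve (b ∷ c ∷ Y ∷ []) ⟩
          (b * c) * Y       ≡⟨ cong (_* Y) det ⟩
          (a * d + 1) * Y   ≡⟨ solve (a ∷ d ∷ Y ∷ []) ⟩
          a * (d * Y) + Y   ∎
        X≡bm : X ≡ b * (c * X ∸ d * Y)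
        X≡bm = sym (trans (*-distribˡ-∸ b (c * X) (d * Y)) (trans (cong (_∸ b * (d * Y)) b[cX]≡b[dY]+X) (m+n∸m≡n (b * (d * Y)) X)))
        Y≡am : Y ≡ a * (c * X ∸ d * Y)
        Y≡am = sym (trans (*-distribˡ-∸ a (c * X) (d * Y)) (trans (cong (_∸ a * (d * Y)) a[cX]≡a[dY]+Y) (m+n∸m≡n (a * (d * Y)) Y)))
        multiple : ∀ m → X ≡ b * m → Y ≡ a * m → X ≡ b × Y ≡ a
        multiple zero X≡0 Y≡0 =
          ⊥-elim (<⇒≱ t (subst₂ (λ u v → (a + c) * u ≤ (b + d) * v) (sym (trans X≡0 (*-zeroʳ b))) refl
                           (subst (_≤ (b + d) * Y) (sym (*-zeroʳ (a + c))) z≤n)))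
        multiple 1 X≡b Y≡a = trans X≡b (*-identityʳ b) , trans Y≡a (*-identityʳ a)
        multiple (suc (suc m)) refl refl = ⊥-elim (refute (b * m + a * m) reg (solve (a ∷ b ∷ m ∷ [])))
      rOnAbove⇒tOnAbove : a * X ≤ b * Y → (b + d) * Y < (a + c) * X → ⊥
      rOnAbove⇒tOnAbove r t with m≤n⇒m<n∨m≡n r
      ... | inj₁ r< = below r< t
      ... | inj₂ r≡ = ¬centre (onLine r≡ t)

  -- The only candidate (x₁ + x₂ , y₁ + y₂) between the two lines is (b , a), twice the centre of L_r.
  midOnOrAbove-r : ∀ x₁ y₁ x₂ y₂ → suc ((x₁ + x₂) + (y₁ + y₂)) ≤ a + a + b + b → ¬ (x₁ + x₂ ≡ b × y₁ + y₂ ≡ a) →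
    midOnOrAbove (a + c) (b + d) (x₁ , y₁) (x₂ , y₂) ≡ midOnOrAbove a b (x₁ , y₁) (x₂ , y₂)
  midOnOrAbove-r x₁ y₁ x₂ y₂ = midOnOrAbove-r′ (x₁ + x₂) (y₁ + y₂)

  centre-r-notOnOrAbove : ∀ x₁ y₁ x₂ y₂ → x₁ + x₂ ≡ b → y₁ + y₂ ≡ a →
    midOnOrAbove (a + c) (b + d) (x₁ , y₁) (x₂ , y₂) ≡ false
  centre-r-notOnOrAbove x₁ y₁ x₂ y₂ X≡b Y≡a rewrite X≡b | Y≡a = >⇒≤ᵇ≡false (≰⇒> cert)
    where
    cert : (a + c) * b ≤ (b + d) * a → ⊥
    cert t = refute 0 (t ⊕ det≥) (solve (a ∷ b ∷ c ∷ d ∷ []))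

  squareMet-r : ∀ i j → suc (suc (i + j)) ≤ a + b → squareMet (a + c) (b + d) i j ≡ squareMet a b i j
  squareMet-r i j reg = trans
    (cong₂ (λ u v → (i <ᵇ b + d) ∧ (j <ᵇ a + c) ∧ u ∧ v) (strictlyAbove-r i (suc j) reg′) (strictlyBelow-r (suc i) j reg))
    (∧-cong-under ((a * i <ᵇ b * suc j) ∧ (b * j <ᵇ a * suc i))
      (λ both → trans (<⇒<ᵇ≡true (≤-trans (i<b (proj₁ (to-∧ both))) (m≤m+n b d))) (sym (<⇒<ᵇ≡true (i<b (proj₁ (to-∧ both))))))
      (λ both → trans (<⇒<ᵇ≡true (≤-trans (j<a (proj₂ (to-∧ both))) (m≤m+n a c))) (sym (<⇒<ᵇ≡true (j<a (proj₂ (to-∧ both)))))))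
    where
    to-∧ : ∀ {x y} → T (x ∧ y) → T x × T y
    to-∧ = Equivalence.to T-∧
    reg′ : i + suc j ≤ a + b
    reg′ = subst (_≤ a + b) (sym (+-suc i j)) (≤-trans (n≤1+n _) reg)
    i<b : T (a * i <ᵇ b * suc j) → i < b
    i<b above = ≰⇒> (cert (T-<ᵇ above))
      where
      cert : a * i < b * suc j → b ≤ i → ⊥
      cert above b≤i = refute b (above ⊕ (a + b) ⊛ b≤i ⊕ b ⊛ reg) (solve (a ∷ b ∷ i ∷ j ∷ []))
    j<a : T (b * j <ᵇ a * suc i) → j < a
    j<a below = ≰⇒> (cert (T-<ᵇ below))
      where
      cert : b * j < a * suc i → a ≤ j → ⊥
      cert below a≤j = refute a (below ⊕ (a + b) ⊛ a≤j ⊕ a ⊛ reg) (solve (a ∷ b ∷ i ∷ j ∷ []))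

  squareMet-aboveLeft : ∀ i j → i < b → a < j → squareMet (a + c) (b + d) i j ≡ false
  squareMet-aboveLeft i j i<b a<j = squareMet-false₄ (a + c) (b + d) i j (≥⇒<ᵇ≡false (≮⇒≥ cert))
    where
    cert : (b + d) * j < (a + c) * suc i → ⊥
    cert t = refute d (t ⊕ (a + c) ⊛ i<b ⊕ (b + d) ⊛ a<j ⊕ det≤ ⊕ 1≤b) (solve (a ∷ b ∷ c ∷ d ∷ i ∷ j ∷ []))

  squareMet-belowRight : ∀ i j → b ≤ i → j < a → squareMet (a + c) (b + d) i j ≡ false
  squareMet-belowRight i j b≤i j<a = squareMet-false₃ (a + c) (b + d) i j (≥⇒<ᵇ≡false (≮⇒≥ cert))
    where
    cert : (a + c) * i < (b + d) * suc j → ⊥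
    cert t = refute 1 (t ⊕ (a + c) ⊛ b≤i ⊕ (b + d) ⊛ j<a ⊕ det≥) (solve (a ∷ b ∷ c ∷ d ∷ i ∷ j ∷ []))

  -- The junction square, with lower-right corner (b , a) the endpoint of L_r.
  junction-lowerRight-notAbove : strictlyAbove (a + c) (b + d) (b , a) ≡ false
  junction-lowerRight-notAbove = ≥⇒<ᵇ≡false (≮⇒≥ cert)
    where
    cert : (a + c) * b < (b + d) * a → ⊥
    cert t = refute 1 (t ⊕ det≥) (solve (a ∷ b ∷ c ∷ d ∷ []))

  junction-upperRight-above : strictlyAbove (a + c) (b + d) (b , suc a) ≡ true
  junction-upperRight-above = <⇒<ᵇ≡true (≰⇒> cert)
    where
    cert : (b + d) * suc a ≤ (a + c) * b → ⊥
    cert t = refute 0 (t ⊕ det≤ ⊕ 1≤b ⊕ 1≤d) (solve (a ∷ b ∷ c ∷ d ∷ []))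

  junction-rightEdge-midOnOrAbove : midOnOrAbove (a + c) (b + d) (b , a) (b , suc a) ≡ true
  junction-rightEdge-midOnOrAbove = ≤⇒≤ᵇ≡true (≮⇒≥ cert)
    where
    cert : (b + d) * (a + suc a) < (a + c) * (b + b) → ⊥
    cert t = refute 0 (t ⊕ det≤ ⊕ det≤ ⊕ 1≤b ⊕ 1≤d) (solve (a ∷ b ∷ c ∷ d ∷ []))

  beyondJunction-notAbove : strictlyAbove (a + c) (b + d) (suc b , a) ≡ false
  beyondJunction-notAbove = ≥⇒<ᵇ≡false (≮⇒≥ cert)
    where
    cert : (a + c) * suc b < (b + d) * a → ⊥
    cert t = refute (a + c + 1) (t ⊕ det≥) (solve (a ∷ b ∷ c ∷ d ∷ []))

  module Junction (b′ : ℕ) (b≡1+b′ : b ≡ suc b′) where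

    private
      b≤1+b′ : b ≤ suc b′
      b≤1+b′ = ≤-reflexive b≡1+b′

      1+b′≤b : suc b′ ≤ b
      1+b′≤b = ≤-reflexive (sym b≡1+b′)

    junction-lowerLeft-above : strictlyAbove (a + c) (b + d) (b′ , a) ≡ true
    junction-lowerLeft-above = <⇒<ᵇ≡true (≰⇒> cert)
      where
      cert : (b + d) * a ≤ (a + c) * b′ → ⊥
      cert t = refute 0 (t ⊕ (a + c) ⊛ 1+b′≤b ⊕ det≤ ⊕ 1≤a ⊕ 1≤c) (solve (a ∷ b ∷ c ∷ d ∷ b′ ∷ []))

    junction-upperLeft-above : strictlyAbove (a + c) (b + d) (b′ , suc a) ≡ true
    junction-upperLeft-above = <⇒<ᵇ≡true (≰⇒> cert)
      where
      cert : (b + d) * suc a ≤ (a + c) * b′ → ⊥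
      cert t = refute (b + d) (t ⊕ (a + c) ⊛ 1+b′≤b ⊕ det≤ ⊕ 1≤a ⊕ 1≤c) (solve (a ∷ b ∷ c ∷ d ∷ b′ ∷ []))

    junction-squareMet : squareMet (a + c) (b + d) b′ a ≡ true
    junction-squareMet = trans
      (cong₂ (λ u v → u ∧ v ∧ strictlyAbove (a + c) (b + d) (b′ , suc a) ∧ ((b + d) * a <ᵇ (a + c) * suc b′))
        (<⇒<ᵇ≡true (≤-trans 1+b′≤b (m≤m+n b d))) (<⇒<ᵇ≡true {a} {a + c} (subst (_≤ a + c) (+-comm a 1) (+-monoʳ-≤ a 1≤c))))
      (cong₂ (λ u v → true ∧ true ∧ u ∧ v) junction-upperLeft-above (<⇒<ᵇ≡true (≰⇒> lowerRight-below)))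
      where
      lowerRight-below : (a + c) * suc b′ ≤ (b + d) * a → ⊥
      lowerRight-below t = refute 0 (t ⊕ (a + c) ⊛ b≤1+b′ ⊕ det≥) (solve (a ∷ b ∷ c ∷ d ∷ b′ ∷ []))

    junction-bottomEdge-midOnOrAbove : midOnOrAbove (a + c) (b + d) (b′ , a) (suc b′ , a) ≡ true
    junction-bottomEdge-midOnOrAbove = ≤⇒≤ᵇ≡true (≮⇒≥ cert)
      where
      cert : (b + d) * (a + a) < (a + c) * (b′ + suc b′) → ⊥
      cert t = refute 0 (t ⊕ (a + c + (a + c)) ⊛ 1+b′≤b ⊕ det≤ ⊕ det≤ ⊕ 1≤a ⊕ 1≤c) (solve (a ∷ b ∷ c ∷ d ∷ b′ ∷ []))

    junction-diagonal-midOnOrAbove : midOnOrAbove (a + c) (b + d) (b′ , suc a) (suc b′ , a) ≡ true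
    junction-diagonal-midOnOrAbove = ≤⇒≤ᵇ≡true (≮⇒≥ cert)
      where
      cert : (b + d) * (suc a + a) < (a + c) * (b′ + suc b′) → ⊥
      cert t = refute (b + d) (t ⊕ (a + c + (a + c)) ⊛ 1+b′≤b ⊕ det≤ ⊕ det≤ ⊕ 1≤a ⊕ 1≤c) (solve (a ∷ b ∷ c ∷ d ∷ b′ ∷ []))

  strictlyAbove-s : ∀ x y → x + y ≤ c + d →
    strictlyAbove (a + c) (b + d) (x + b , y + a) ≡ strictlyAbove c d (x , y)
  strictlyAbove-s x y reg = <ᵇ-cong (λ t → ≰⇒> (tAbove⇒sAbove t)) (λ s → ≰⇒> (sAbove⇒tAbove s))
    where
    tAbove⇒sAbove : (a + c) * (x + b) < (b + d) * (y + a) → d * y ≤ c * x → ⊥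
    tAbove⇒sAbove t s = refute d ((c + d) ⊛ t ⊕ (a + b + c + d) ⊛ s ⊕ reg ⊕ (x + y) ⊛ det≤ ⊕ (c + d) ⊛ det≥ ⊕ 1≤c)
                                   (solve (a ∷ b ∷ c ∷ d ∷ x ∷ y ∷ []))
    sAbove⇒tAbove : c * x < d * y → (b + d) * (y + a) ≤ (a + c) * (x + b) → ⊥
    sAbove⇒tAbove s t = refute x (d ⊛ t ⊕ (b + d) ⊛ s ⊕ x ⊛ det≥ ⊕ d ⊛ det≤ ⊕ 1≤b) (solve (a ∷ b ∷ c ∷ d ∷ x ∷ y ∷ []))

  strictlyBelow-s : ∀ x y → 1 ≤ x → suc (x + y) ≤ c + c + d + d →
    ((b + d) * (y + a) <ᵇ (a + c) * (x + b)) ≡ (d * y <ᵇ c * x)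
  strictlyBelow-s x y 1≤x reg = <ᵇ-cong (λ t → ≰⇒> (tBelow⇒sBelow t)) (λ s → ≰⇒> (sBelow⇒tBelow s))
    where
    tBelow⇒sBelow : (b + d) * (y + a) < (a + c) * (x + b) → c * x ≤ d * y → ⊥
    tBelow⇒sBelow t s = refute 0 (d ⊛ t ⊕ (b + d) ⊛ s ⊕ 1≤x ⊕ x ⊛ det≥ ⊕ d ⊛ det≤) (solve (a ∷ b ∷ c ∷ d ∷ x ∷ y ∷ []))
    sBelow⇒tBelow : d * y < c * x → (a + c) * (x + b) ≤ (b + d) * (y + a) → ⊥
    sBelow⇒tBelow s t = refute (a + b) ((c + d) ⊛ t ⊕ (a + b + c + d) ⊛ s ⊕ reg ⊕ (x + y) ⊛ det≤ ⊕ (c + d) ⊛ det≥)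
                                       (solve (a ∷ b ∷ c ∷ d ∷ x ∷ y ∷ []))

  squareMet-s : ∀ i j → suc (i + j) ≤ c + d → squareMet (a + c) (b + d) (i + b) (j + a) ≡ squareMet c d i j
  squareMet-s i j reg =
    cong₂ _∧_ (+-cancel-<ᵇ i b d) (cong₂ _∧_ (+-cancel-<ᵇ j a c)
      (cong₂ _∧_ (strictlyAbove-s i (suc j) reg′) (strictlyBelow-s (suc i) j (s≤s z≤n) reg″)))
    where
    +-cancel-<ᵇ : ∀ m k n → (m + k <ᵇ k + n) ≡ (m <ᵇ n)
    +-cancel-<ᵇ m k n = <ᵇ-cong (λ lt → +-cancelˡ-< k m n (subst (_< k + n) (+-comm m k) lt))
                               (λ lt → subst (_< k + n) (+-comm k m) (+-monoʳ-< k lt))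
    reg′ : i + suc j ≤ c + d
    reg′ = subst (_≤ c + d) (sym (+-suc i j)) reg
    reg″ : suc (suc i + j) ≤ c + c + d + d
    reg″ = ≤-trans (s≤s reg) (subst (suc (c + d) ≤_) twice (+-monoˡ-≤ (c + d) (≤-trans 1≤c (m≤m+n c d))))
      where
      twice : (c + d) + (c + d) ≡ c + c + d + d
      twice = solve (c ∷ d ∷ [])

  private
    midOnOrAbove-s′ : ∀ X Y → 1 ≤ X → suc (X + Y) ≤ c + c + d + d → ¬ (X ≡ d × Y ≡ c) →
      ((a + c) * (X + (b + b)) ≤ᵇ (b + d) * (Y + (a + a))) ≡ (c * X ≤ᵇ d * Y)
    midOnOrAbove-s′ X Y 1≤X reg ¬centre =
      ≤ᵇ-cong (λ t → ≮⇒≥ (λ s → tOnAbove⇒sOnAbove t s)) (λ s → ≮⇒≥ (sOnAbove⇒tOnAbove s))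
      where
      tOnAbove⇒sOnAbove : (a + c) * (X + (b + b)) ≤ (b + d) * (Y + (a + a)) → d * Y < c * X → ⊥
      tOnAbove⇒sOnAbove t s = refute (a + b + c + d) ((c + d) ⊛ t ⊕ (a + b + c + d) ⊛ s ⊕ reg ⊕ (X + Y) ⊛ det≤ ⊕ (c + d + c + d) ⊛ det≥)
                                                     (solve (a ∷ b ∷ c ∷ d ∷ X ∷ Y ∷ []))
      above : c * X < d * Y → (b + d) * (Y + (a + a)) < (a + c) * (X + (b + b)) → ⊥
      above s t = refute X (d ⊛ t ⊕ (b + d) ⊛ s ⊕ X ⊛ det≥ ⊕ (d + d) ⊛ det≤ ⊕ 1≤b) (solve (a ∷ b ∷ c ∷ d ∷ X ∷ Y ∷ []))
      -- c X = d Y forces (X , Y) = m (d , c) with m = b Y − a X, and m ≥ 2 is out of range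
      onLine : c * X ≡ d * Y → (b + d) * (Y + (a + a)) < (a + c) * (X + (b + b)) → X ≡ d × Y ≡ c
      onLine cX≡dY t = multiple (b * Y ∸ a * X) X≡dm Y≡cm
        where
        open ≡-Reasoning
        d[bY]≡d[aX]+X : d * (b * Y) ≡ d * (a * X) + X
        d[bY]≡d[aX]+X = begin
          d * (b * Y)       ≡⟨ solve (b ∷ d ∷ Y ∷ []) ⟩
          b * (d * Y)       ≡⟨ cong (b *_) cX≡dY ⟨
          b * (c * X)       ≡⟨ *-assoc b c X ⟨
          (b * c) * X       ≡⟨ cong (_* X) det ⟩
          (a * d + 1) * X   ≡⟨ solve (a ∷ d ∷ X ∷ []) ⟩
          d * (a * X) + X   ∎
        c[bY]≡c[aX]+Y : c * (b * Y) ≡ c * (a * X) + Y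
        c[bY]≡c[aX]+Y = begin
          c * (b * Y)       ≡⟨ solve (b ∷ c ∷ Y ∷ []) ⟩
          (b * c) * Y       ≡⟨ cong (_* Y) det ⟩
          (a * d + 1) * Y   ≡⟨ solve (a ∷ d ∷ Y ∷ []) ⟩
          a * (d * Y) + Y   ≡⟨ cong (λ v → a * v + Y) cX≡dY ⟨
          a * (c * X) + Y   ≡⟨ solve (a ∷ c ∷ X ∷ Y ∷ []) ⟩
          c * (a * X) + Y   ∎
        X≡dm : X ≡ d * (b * Y ∸ a * X)
        X≡dm = sym (trans (*-distribˡ-∸ d (b * Y) (a * X)) (trans (cong (_∸ d * (a * X)) d[bY]≡d[aX]+X) (m+n∸m≡n (d * (a * X)) X)))
        Y≡cm : Y ≡ c * (b * Y ∸ a * X)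
        Y≡cm = sym (trans (*-distribˡ-∸ c (b * Y) (a * X)) (trans (cong (_∸ c * (a * X)) c[bY]≡c[aX]+Y) (m+n∸m≡n (c * (a * X)) Y)))
        multiple : ∀ m → X ≡ d * m → Y ≡ c * m → X ≡ d × Y ≡ c
        multiple zero X≡0 _ = ⊥-elim (<⇒≱ 1≤X (≤-reflexive (trans X≡0 (*-zeroʳ d))))
        multiple 1 X≡d Y≡c = trans X≡d (*-identityʳ d) , trans Y≡c (*-identityʳ c)
        multiple (suc (suc m)) refl refl = ⊥-elim (refute m (t ⊕ suc (suc m) ⊛ det≥ ⊕ det≤ ⊕ det≤) (solve (a ∷ b ∷ c ∷ d ∷ m ∷ [])))
      sOnAbove⇒tOnAbove : c * X ≤ d * Y → (b + d) * (Y + (a + a)) < (a + c) * (X + (b + b)) → ⊥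
      sOnAbove⇒tOnAbove s t with m≤n⇒m<n∨m≡n s
      ... | inj₁ s< = above s< t
      ... | inj₂ s≡ = ¬centre (onLine s≡ t)

    midOnOrAbove-shift : ∀ P Q x₁ y₁ x₂ y₂ u v →
      midOnOrAbove P Q (x₁ + u , y₁ + v) (x₂ + u , y₂ + v) ≡ (P * ((x₁ + x₂) + (u + u)) ≤ᵇ Q * ((y₁ + y₂) + (v + v)))
    midOnOrAbove-shift P Q x₁ y₁ x₂ y₂ u v =
      cong₂ (λ X Y → P * X ≤ᵇ Q * Y) (solve (x₁ ∷ x₂ ∷ u ∷ [])) (solve (y₁ ∷ y₂ ∷ v ∷ []))

  midOnOrAbove-s : ∀ x₁ y₁ x₂ y₂ → 1 ≤ x₁ + x₂ → suc ((x₁ + x₂) + (y₁ + y₂)) ≤ c + c + d + d →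
    ¬ (x₁ + x₂ ≡ d × y₁ + y₂ ≡ c) →
    midOnOrAbove (a + c) (b + d) (x₁ + b , y₁ + a) (x₂ + b , y₂ + a) ≡ midOnOrAbove c d (x₁ , y₁) (x₂ , y₂)
  midOnOrAbove-s x₁ y₁ x₂ y₂ 1≤X reg ¬centre =
    trans (midOnOrAbove-shift (a + c) (b + d) x₁ y₁ x₂ y₂ b a) (midOnOrAbove-s′ (x₁ + x₂) (y₁ + y₂) 1≤X reg ¬centre)

  centre-s-notOnOrAbove : ∀ x₁ y₁ x₂ y₂ → x₁ + x₂ ≡ d → y₁ + y₂ ≡ c →
    midOnOrAbove (a + c) (b + d) (x₁ + b , y₁ + a) (x₂ + b , y₂ + a) ≡ false
  centre-s-notOnOrAbove x₁ y₁ x₂ y₂ X≡d Y≡c =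
    trans (midOnOrAbove-shift (a + c) (b + d) x₁ y₁ x₂ y₂ b a) (centre X≡d Y≡c)
    where
    centre : x₁ + x₂ ≡ d → y₁ + y₂ ≡ c → ((a + c) * ((x₁ + x₂) + (b + b)) ≤ᵇ (b + d) * ((y₁ + y₂) + (a + a))) ≡ false
    centre X≡d Y≡c rewrite X≡d | Y≡c = >⇒≤ᵇ≡false (≰⇒> cert)
      where
      cert : (a + c) * (d + (b + b)) ≤ (b + d) * (c + (a + a)) → ⊥
      cert t = refute 0 (t ⊕ det≥) (solve (a ∷ b ∷ c ∷ d ∷ []))

module MediantSquares (a′ b′ c′ d′ : ℕ) (det : suc b′ * suc c′ ≡ suc a′ * suc d′ + 1) (c<d : suc c′ < suc d′) where

  open import Data.Nat
  open Squares
  open Items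
  open import Data.Nat.Properties
  open import Data.Nat.Tactic.RingSolver using (solve-∀)
  open import Data.Bool using (true; false; if_then_else_)
  open import Function using (_∘_)
  open import Data.List using (List; []; _∷_; _++_; [_]; concatMap; applyUpTo; upTo; map)
  open import Data.List.Properties using (++-identityʳ; map-concatMap)
  open import Data.Product using (_,_)
  open import Data.Empty using (⊥-elim)
  open import Relation.Binary.Definitions using (tri<; tri≈; tri>)
  open import Relation.Binary.PropositionalEquality hiding ([_])
  open import Relation.Nullary using (yes; no)

  a b c d : ℕ
  a = suc a′
  b = suc b′
  c = suc c′
  d = suc d′

  open Neighbours a b c d det (s≤s z≤n) (s≤s z≤n) (s≤s z≤n) c<d public
  open Junction b′ refl public
  open Translation b a public

  private
    -- the diagonals of t: those of r, the junction diagonal N, then those of s shifted by N + 1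
    N : ℕ
    N = a′ + b

    ≥-rest : ∀ i j x y n → i + j ≡ n → i ≤ x → n ≡ x + y → y ≤ j
    ≥-rest i j x y n i+j≡n i≤x n≡x+y =
      ≮⇒≥ λ j<y → <-irrefl refl (subst (_< n) i+j≡n (subst (i + j <_) (sym n≡x+y) (+-mono-≤-< i≤x j<y)))

    ≤-rest : ∀ i j x y n → i + j ≡ n → x ≤ i → n ≡ x + y → j ≤ y
    ≤-rest i j x y n i+j≡n x≤i n≡x+y =
      ≮⇒≥ λ y<j → <-irrefl refl (subst (_< n) (sym n≡x+y) (subst (x + y <_) i+j≡n (+-mono-≤-< x≤i y<j)))

    squares-r : squares a b ≡ concatMap (diagonal a b) (upTo N)
    squares-r = begin
      concatMap (diagonal a b) (upTo (suc N))                   ≡⟨ cong (λ m → concatMap (diagonal a b) (upTo m)) (+-comm 1 N) ⟩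
      concatMap (diagonal a b) (applyUpTo (λ i → i) (N + 1))    ≡⟨ concatMap-applyUpTo-+ (diagonal a b) (λ i → i) N 1 ⟩
      concatMap (diagonal a b) (upTo N) ++ (diagonal a b (N + 0) ++ []) ≡⟨ cong (λ ds → concatMap (diagonal a b) (upTo N) ++ (ds ++ [])) beyond ⟩
      concatMap (diagonal a b) (upTo N) ++ []                   ≡⟨ ++-identityʳ _ ⟩
      concatMap (diagonal a b) (upTo N)                         ∎
      where
      open ≡-Reasoning
      N+0≡b′+a : N + 0 ≡ b′ + a
      N+0≡b′+a = identity a′ b′
        where
        identity : ∀ a′ b′ → a′ + suc b′ + 0 ≡ b′ + suc a′
        identity = solve-∀
      beyond : diagonal a b (N + 0) ≡ []
      beyond = diagonal-[] a b (N + 0) notMet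
        where
        notMet : ∀ i j → i + j ≡ N + 0 → squareMet a b i j ≡ false
        notMet i j i+j≡n with i ≤? b′
        ... | yes i≤b′ = squareMet-aboveRange a b i j (≥-rest i j b′ a (N + 0) i+j≡n i≤b′ N+0≡b′+a)
        ... | no i≰b′ = squareMet-rightOfRange a b i j (≰⇒> i≰b′)

    diagonal-r : ∀ n → n < N → diagonal (a + c) (b + d) n ≡ diagonal a b n
    diagonal-r n n<N = concatMap-applyUpTo-cong (cell (a + c) (b + d) n) (cell a b n) (λ i → i) (λ i → i) (suc n) λ i i≤n →
      cong (λ met → if met then [ (i , n ∸ i) ] else [])
           (squareMet-r i (n ∸ i) (subst (λ m → suc (suc m) ≤ a + b) (sym (m+[n∸m]≡n (≤-pred i≤n))) (s≤s n<N)))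

    diagonal-junction : diagonal (a + c) (b + d) (N + 0) ≡ [ (b′ , a) ]
    diagonal-junction = diagonal-single (a + c) (b + d) (N + 0) b′ a (identity a′ b′) junction-squareMet notMet
      where
      identity : ∀ a′ b′ → b′ + suc a′ ≡ a′ + suc b′ + 0
      identity = solve-∀
      identity′ : ∀ a′ b′ → suc (a′ + suc b′ + 0) ≡ b′ + suc (suc a′)
      identity′ = solve-∀
      identity″ : ∀ a′ b′ → a′ + suc b′ + 0 ≡ suc b′ + a′
      identity″ = solve-∀
      notMet : ∀ i j → i + j ≡ N + 0 → i ≢ b′ → squareMet (a + c) (b + d) i j ≡ false
      notMet i j i+j≡n i≢b′ with <-cmp i b′
      ... | tri< i<b′ _ _ = squareMet-aboveLeft i j (≤-trans i<b′ (n≤1+n b′))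
                              (≥-rest (suc i) j b′ (suc a) (suc (N + 0)) (cong suc i+j≡n) i<b′ (identity′ a′ b′))
      ... | tri≈ _ i≡b′ _ = ⊥-elim (i≢b′ i≡b′)
      ... | tri> _ _ b′<i = squareMet-belowRight i j b′<i (s≤s (≤-rest i j b a′ (N + 0) i+j≡n b′<i (identity″ a′ b′)))

    diagonal-s : ∀ m → m < c + d → diagonal (a + c) (b + d) (N + suc m) ≡ map translate (diagonal c d m)
    diagonal-s m m<c+d = begin
      concatMap f (upTo (suc n))                         ≡⟨ cong (λ l → concatMap f (upTo l)) (identity a′ b′ m) ⟩
      concatMap f (applyUpTo (λ i → i) (b + (suc m + a)))  ≡⟨ concatMap-applyUpTo-+ f (λ i → i) b (suc m + a) ⟩
      concatMap f (upTo b) ++ concatMap f (applyUpTo (λ i → b + i) (suc m + a))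
        ≡⟨ cong (concatMap f (upTo b) ++_) (concatMap-applyUpTo-+ f (λ i → b + i) (suc m) a) ⟩
      concatMap f (upTo b) ++ (concatMap f (applyUpTo (λ i → b + i) (suc m)) ++ concatMap f (applyUpTo (λ i → b + (suc m + i)) a))
        ≡⟨ cong₂ (λ u v → u ++ (concatMap f (applyUpTo (λ i → b + i) (suc m)) ++ v)) before after ⟩
      concatMap f (applyUpTo (λ i → b + i) (suc m)) ++ []  ≡⟨ ++-identityʳ _ ⟩
      concatMap f (applyUpTo (λ i → b + i) (suc m))        ≡⟨ middle ⟩
      map translate (diagonal c d m)                       ∎
      where
      open ≡-Reasoning
      n : ℕ
      n = N + suc m
      f : ℕ → List Pt
      f = cell (a + c) (b + d) n
      identity : ∀ a′ b′ m → suc (a′ + suc b′ + suc m) ≡ suc b′ + (suc m + suc a′)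
      identity = solve-∀
      n≡b′+[2+a′+m] : ∀ a′ b′ m → a′ + suc b′ + suc m ≡ b′ + (suc (suc a′) + m)
      n≡b′+[2+a′+m] = solve-∀
      n≡[b+1+m]+a′ : ∀ a′ b′ m → a′ + suc b′ + suc m ≡ (suc b′ + suc m) + a′
      n≡[b+1+m]+a′ = solve-∀
      before : concatMap f (upTo b) ≡ []
      before = concatMap-applyUpTo-[] f (λ i → i) b λ i i<b →
        cell-[] (a + c) (b + d) n i (≤-trans (≤-pred i<b) (≤-trans (m≤m+n b′ _) (≤-reflexive (sym (n≡b′+[2+a′+m] a′ b′ m)))))
          λ j i+j≡n → squareMet-aboveLeft i j i<b
            (≤-trans (s≤s (s≤s (m≤m+n a′ m))) (≥-rest i j b′ (suc (suc a′) + m) n i+j≡n (≤-pred i<b) (n≡b′+[2+a′+m] a′ b′ m)))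
      after : concatMap f (applyUpTo (λ i → b + (suc m + i)) a) ≡ []
      after = concatMap-applyUpTo-[] f (λ i → b + (suc m + i)) a λ i i<a →
        cell-[] (a + c) (b + d) n (b + (suc m + i)) (i≤n i i<a) λ j i+j≡n →
          squareMet-belowRight (b + (suc m + i)) j (m≤m+n b (suc m + i))
            (s≤s (≤-rest (b + (suc m + i)) j (b + suc m) a′ n i+j≡n (b+1+m≤ i) (n≡[b+1+m]+a′ a′ b′ m)))
        where
        b+1+m≤ : ∀ i → b + suc m ≤ b + (suc m + i)
        b+1+m≤ i = ≤-trans (m≤m+n (b + suc m) i) (≤-reflexive (+-assoc b (suc m) i))
        i≤n : ∀ i → i < a → b + (suc m + i) ≤ n
        i≤n i i<a = subst (b + (suc m + i) ≤_) (sym (n≡[b+1+m]+a′ a′ b′ m))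
                      (subst (_≤ b + suc m + a′) (+-assoc b (suc m) i) (+-monoʳ-≤ (b + suc m) (≤-pred i<a)))
      middle : concatMap f (applyUpTo (λ i → b + i) (suc m)) ≡ map translate (diagonal c d m)
      middle = trans
        (concatMap-applyUpTo-cong f (map translate ∘ cell c d m) (λ i → b + i) (λ i → i) (suc m) λ i i≤m →
          let i+[m∸i]≡m = m+[n∸m]≡n {i} {m} (≤-pred i≤m) in begin
          f (b + i)
            ≡⟨ cell-≡ (a + c) (b + d) n (b + i) (m ∸ i + a) (shifted i (m ∸ i) i+[m∸i]≡m) ⟩
          (if squareMet (a + c) (b + d) (b + i) (m ∸ i + a) then [ (b + i , m ∸ i + a) ] else [])
            ≡⟨ cong (λ x → if squareMet (a + c) (b + d) x (m ∸ i + a) then [ (x , m ∸ i + a) ] else []) (+-comm b i) ⟩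
          (if squareMet (a + c) (b + d) (i + b) (m ∸ i + a) then [ translate (i , m ∸ i) ] else [])
            ≡⟨ cong (λ met → if met then [ translate (i , m ∸ i) ] else [])
                    (squareMet-s i (m ∸ i) (subst (_< c + d) (sym i+[m∸i]≡m) m<c+d)) ⟩
          (if squareMet c d i (m ∸ i) then [ translate (i , m ∸ i) ] else [])
            ≡⟨ map-if (squareMet c d i (m ∸ i)) ⟨
          map translate (cell c d m i) ∎)
        (sym (map-concatMap translate (cell c d m) (upTo (suc m))))
        where
        map-if : ∀ {p} met → map translate (if met then [ p ] else []) ≡ (if met then [ translate p ] else [])
        map-if true = refl
        map-if false = refl
        shifted : ∀ i j → i + j ≡ m → b + i + (j + a) ≡ n
        shifted i j i+j≡m = trans (identity′ a′ b′ i j) (cong (λ l → a′ + suc b′ + suc l) i+j≡m)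
          where
          identity′ : ∀ a′ b′ i j → suc b′ + i + (j + suc a′) ≡ a′ + suc b′ + suc (i + j)
          identity′ = solve-∀

  squares-mediant : squares (a + c) (b + d) ≡ squares a b ++ (b′ , a) ∷ map translate (squares c d)
  squares-mediant = begin
    concatMap diagonal-t (upTo ((a + c) + (b + d)))
      ≡⟨ cong (λ l → concatMap diagonal-t (upTo l)) (identity a′ b′ c d) ⟩
    concatMap diagonal-t (applyUpTo (λ i → i) (N + suc (c + d)))
      ≡⟨ concatMap-applyUpTo-+ diagonal-t (λ i → i) N (suc (c + d)) ⟩
    concatMap diagonal-t (upTo N) ++ diagonal-t (N + 0) ++ concatMap diagonal-t (applyUpTo (λ i → N + suc i) (c + d))
      ≡⟨ cong₂ _++_ r-part (cong₂ _++_ diagonal-junction s-part) ⟩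
    concatMap (diagonal a b) (upTo N) ++ (b′ , a) ∷ map translate (squares c d)
      ≡⟨ cong (_++ (b′ , a) ∷ map translate (squares c d)) squares-r ⟨
    squares a b ++ (b′ , a) ∷ map translate (squares c d) ∎
    where
    open ≡-Reasoning
    identity : ∀ a′ b′ c d → suc a′ + c + (suc b′ + d) ≡ a′ + suc b′ + suc (c + d)
    identity = solve-∀
    diagonal-t : ℕ → List Pt
    diagonal-t = diagonal (a + c) (b + d)
    r-part : concatMap diagonal-t (upTo N) ≡ concatMap (diagonal a b) (upTo N)
    r-part = concatMap-applyUpTo-cong diagonal-t (diagonal a b) (λ i → i) (λ i → i) N diagonal-r
    s-part : concatMap diagonal-t (applyUpTo (λ i → N + suc i) (c + d)) ≡ map translate (squares c d)
    s-part = trans (concatMap-applyUpTo-cong diagonal-t (map translate ∘ diagonal c d) (λ i → N + suc i) (λ i → i) (c + d) diagonal-s)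
                   (sym (map-concatMap translate (diagonal c d) (upTo (c + d))))

module MediantSigns (k a′ b′ c′ d′ : ℕ) (det : suc b′ * suc c′ ≡ suc a′ * suc d′ + 1) (c<d : suc c′ < suc d′) where

  open import Data.Nat
  open Comparisons
  open Squares using (squares-inRange; squares-first; squares-last)
  open UnitSquare
  open Items
  open Centre
  open EndSigns
  open SignRuns using (lastOr)
  open MediantSquares a′ b′ c′ d′ det c<d
  open import Data.Bool using (Bool; true; false; not; if_then_else_)
  open import Data.Nat.Properties
  open import Data.Nat.Tactic.RingSolver using (solve-∀)
  open import Data.List using (List; []; _∷_; _++_; [_]; concatMap; map; replicate)
  open import Data.List.Properties using (++-assoc; concatMap-++; concatMap-map)
  open import Data.List.Relation.Unary.All using (All; []; _∷_; tail)
  open import Data.Product using (_×_; _,_; proj₁; proj₂; uncurry)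
  open import Data.Empty using (⊥; ⊥-elim)
  open import Function using (_∘_)
  open import Relation.Binary.PropositionalEquality hiding ([_])

  signsT signsR signsS : Item → List Bool
  signsT = itemSigns false k (a + c) (b + d)
  signsR = itemSigns true k a b
  signsS = itemSigns true k c d

  private
    notBothEven : ∀ {P Q x y} → Q * x ≡ P * y + 1 → NotBothEven P Q
    notBothEven {P} {Q} {x} {y} Qx≡Py+1 u v refl refl =
      even≢odd (v * x) (u * y) (trans (identity v x) (trans Qx≡Py+1 (identity′ u y)))
      where
      identity : ∀ v x → 2 * (v * x) ≡ (v + v) * x
      identity = solve-∀
      identity′ : ∀ u y → (u + u) * y + 1 ≡ suc (2 * (u * y))
      identity′ = solve-∀

    notBothEven-r : NotBothEven a b
    notBothEven-r = notBothEven {x = c} {y = d} det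

    notBothEven-s : NotBothEven c d
    notBothEven-s u v c≡u+u d≡v+v =
      notBothEven {d} {c} {b} {a} (trans (*-comm c b) (trans det (cong (_+ 1) (*-comm a d)))) v u d≡v+v c≡u+u

    ifSign : ∀ cc mr mt → (cc ≡ true → mt ≡ false) → (cc ≡ false → mr ≡ mt) → (if cc then true else not mr) ≡ not mt
    ifSign true  _ _ centre _ = cong not (sym (centre refl))
    ifSign false _ _ _ off = cong not (off refl)

    midpoint-containsCentre : ∀ P Q x₁ y₁ x₂ y₂ → x₁ + x₂ ≡ Q → y₁ + y₂ ≡ P →
      containsCentre P Q (x₁ , y₁) (x₂ , y₂) ≡ true
    midpoint-containsCentre P Q x₁ y₁ x₂ y₂ refl refl = containsCentre-midpoint x₁ y₁ x₂ y₂

    false≢true : false ≢ true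
    false≢true ()

    edgeSigns-r : ∀ x₁ y₁ x₂ y₂ → suc ((x₁ + x₂) + (y₁ + y₂)) ≤ a + a + b + b →
      (containsCentre a b (x₁ , y₁) (x₂ , y₂) ≡ true → x₁ + x₂ ≡ b × y₁ + y₂ ≡ a) →
      signsR (edge (x₁ , y₁) (x₂ , y₂)) ≡ signsT (edge (x₁ , y₁) (x₂ , y₂))
    edgeSigns-r x₁ y₁ x₂ y₂ reg centred = cong (replicate k)
      (ifSign (containsCentre a b (x₁ , y₁) (x₂ , y₂)) (midOnOrAbove a b (x₁ , y₁) (x₂ , y₂))
              (midOnOrAbove (a + c) (b + d) (x₁ , y₁) (x₂ , y₂))
        (λ cc → uncurry (centre-r-notOnOrAbove x₁ y₁ x₂ y₂) (centred cc))
        (λ ¬cc → sym (midOnOrAbove-r x₁ y₁ x₂ y₂ reg λ (X≡b , Y≡a) →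
                    false≢true (trans (sym ¬cc) (midpoint-containsCentre a b x₁ y₁ x₂ y₂ X≡b Y≡a)))))

    edgeSigns-s : ∀ x₁ y₁ x₂ y₂ → 1 ≤ x₁ + x₂ → suc ((x₁ + x₂) + (y₁ + y₂)) ≤ c + c + d + d →
      (containsCentre c d (x₁ , y₁) (x₂ , y₂) ≡ true → x₁ + x₂ ≡ d × y₁ + y₂ ≡ c) →
      signsS (edge (x₁ , y₁) (x₂ , y₂)) ≡ signsT (translateItem (edge (x₁ , y₁) (x₂ , y₂)))
    edgeSigns-s x₁ y₁ x₂ y₂ 1≤X reg centred = cong (replicate k)
      (ifSign (containsCentre c d (x₁ , y₁) (x₂ , y₂)) (midOnOrAbove c d (x₁ , y₁) (x₂ , y₂))
              (midOnOrAbove (a + c) (b + d) (x₁ + b , y₁ + a) (x₂ + b , y₂ + a))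
        (λ cc → uncurry (centre-s-notOnOrAbove x₁ y₁ x₂ y₂) (centred cc))
        (λ ¬cc → sym (midOnOrAbove-s x₁ y₁ x₂ y₂ 1≤X reg λ (X≡d , Y≡c) →
                    false≢true (trans (sym ¬cc) (midpoint-containsCentre c d x₁ y₁ x₂ y₂ X≡d Y≡c)))))

    squareSigns-r : ∀ s → InRange a b s → All (λ e → signsR e ≡ signsT e) (squareItems s)
    squareSigns-r (i , j) inRange =
        sym (triangleSign-cong (strictlyAbove-r i j (corner₀₀-inRange inRange)) (strictlyAbove-r (suc i) j (corner₁₀-inRange inRange))
                               (strictlyAbove-r i (suc j) (corner₀₁-inRange inRange)))
      ∷ edgeSigns-r i (suc j) (suc i) j (diagonal-inRange a b i j inRange) (diagonal-containsCentre a b i j notBothEven-r)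
      ∷ sym (triangleSign-cong (strictlyAbove-r (suc i) (suc j) (corner₁₁-inRange inRange)) (strictlyAbove-r (suc i) j (corner₁₀-inRange inRange))
                               (strictlyAbove-r i (suc j) (corner₀₁-inRange inRange)))
      ∷ []

    commonSideSigns-r : ∀ p q → InRange a b p → signsR (commonSide p q) ≡ signsT (commonSide p q)
    commonSideSigns-r (i , j) q inRange = commonSide-elim {R = λ e → signsR e ≡ signsT e} i j q
      (edgeSigns-r (suc i) j (suc i) (suc j) (vertical-inRange a b i j inRange) (vertical-containsCentre a b i j notBothEven-r))
      (edgeSigns-r i (suc j) (suc i) (suc j) (horizontal-inRange a b i j inRange) (horizontal-containsCentre a b i j notBothEven-r))

    1≤n+suc-n : ∀ n → 1 ≤ n + suc n
    1≤n+suc-n n = subst (1 ≤_) (sym (+-suc n n)) (s≤s z≤n)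

    squareSigns-s : ∀ s → InRange c d s → All (λ e → signsS e ≡ signsT (translateItem e)) (squareItems s)
    squareSigns-s (i , j) inRange =
        sym (triangleSign-cong (strictlyAbove-s i j (corner₀₀-inRange inRange)) (strictlyAbove-s (suc i) j (corner₁₀-inRange inRange))
                               (strictlyAbove-s i (suc j) (corner₀₁-inRange inRange)))
      ∷ edgeSigns-s i (suc j) (suc i) j (1≤n+suc-n i) (diagonal-inRange c d i j inRange) (diagonal-containsCentre c d i j notBothEven-s)
      ∷ sym (triangleSign-cong (strictlyAbove-s (suc i) (suc j) (corner₁₁-inRange inRange)) (strictlyAbove-s (suc i) j (corner₁₀-inRange inRange))
                               (strictlyAbove-s i (suc j) (corner₀₁-inRange inRange)))
      ∷ []

    commonSideSigns-s : ∀ p q → InRange c d p → signsS (commonSide p q) ≡ signsT (translateItem (commonSide p q))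
    commonSideSigns-s (i , j) q inRange = commonSide-elim {R = λ e → signsS e ≡ signsT (translateItem e)} i j q
      (edgeSigns-s (suc i) j (suc i) (suc j) (s≤s z≤n) (vertical-inRange c d i j inRange) (vertical-containsCentre c d i j notBothEven-s))
      (edgeSigns-s i (suc j) (suc i) (suc j) (1≤n+suc-n i) (horizontal-inRange c d i j inRange) (horizontal-containsCentre c d i j notBothEven-s))

  signs-r : All (λ e → signsR e ≡ signsT e) (items (squares a b))
  signs-r = items-All (squares a b) (squares-inRange a b) squareSigns-r commonSideSigns-r

  signs-s : All (λ e → signsS e ≡ signsT (translateItem e)) (items (squares c d))
  signs-s = items-All (squares c d) (squares-inRange c d) squareSigns-s commonSideSigns-s

  private
    concatMap-All-cong : ∀ {X Y : Set} {f g : X → List Y} {xs} → All (λ x → f x ≡ g x) xs → concatMap f xs ≡ concatMap g xs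
    concatMap-All-cong [] = refl
    concatMap-All-cong (eq ∷ eqs) = cong₂ _++_ eq (concatMap-All-cong eqs)

    replicate-+-++ : ∀ {X : Set} (x : X) m n zs → replicate m x ++ replicate n x ++ zs ≡ replicate (m + n) x ++ zs
    replicate-+-++ x zero n zs = refl
    replicate-+-++ x (suc m) n zs = cong (x ∷_) (replicate-+-++ x m n zs)

    replicate-++-∷ : ∀ {X : Set} (x : X) m zs → replicate m x ++ x ∷ zs ≡ x ∷ replicate m x ++ zs
    replicate-++-∷ x zero zs = refl
    replicate-++-∷ x (suc m) zs = cong (x ∷_) (replicate-++-∷ x m zs)

    restR restS : List Item
    restR = edge (0 , 1) (1 , 0) ∷ tri (1 , 1) (1 , 0) (0 , 1) ∷ proj₁ (items-squares a′ b′)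
    restS = edge (0 , 1) (1 , 0) ∷ tri (1 , 1) (1 , 0) (0 , 1) ∷ proj₁ (items-squares c′ d′)

    items-r : items (squares a b) ≡ lowerTri₀ ∷ restR
    items-r = proj₂ (items-squares a′ b′)

    items-s : items (squares c d) ≡ lowerTri₀ ∷ restS
    items-s = proj₂ (items-squares c′ d′)

  gr gs : List Bool
  gr = concatMap signsR restR
  gs = replicate k false ++ concatMap signsS (proj₁ (items-squares c′ d′))

  signSeq-r : signSeq true k (a , b) ≡ false ∷ gr
  signSeq-r = cong (signList true k a b) items-r

  gr-last : lastOr false gr ≡ true
  gr-last = signs-last true k a′ b′ restR items-r

  -- L_s starts with the lower triangle (−), the diagonal (−, not the central edge as c < d),
  -- and the upper triangle (−, with two vertices above L_s).
  signsS-restS : concatMap signsS restS ≡ false ∷ gs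
  signsS-restS = begin
    signsS (edge (0 , 1) (1 , 0)) ++ signsS (tri (1 , 1) (1 , 0) (0 , 1)) ++ rest  ≡⟨ cong₂ (λ u v → u ++ v ++ rest) firstDiagonal upperTriangle ⟩
    replicate k false ++ false ∷ rest                                              ≡⟨ replicate-++-∷ false k rest ⟩
    false ∷ gs                                                                     ∎
    where
    open ≡-Reasoning
    rest : List Bool
    rest = concatMap signsS (proj₁ (items-squares c′ d′))
    notCentral : containsCentre c d (0 , 1) (1 , 0) ≡ false
    notCentral with containsCentre c d (0 , 1) (1 , 0) in cc
    ... | false = refl
    ... | true = ⊥-elim (<⇒≱ c<d (≤-trans (≤-reflexive (sym (proj₁ (diagonal-containsCentre c d 0 0 notBothEven-s cc)))) (s≤s z≤n)))
    firstDiagonal : signsS (edge (0 , 1) (1 , 0)) ≡ replicate k false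
    firstDiagonal = cong (replicate k) (cong₂ (λ cc m → if cc then true else not m) notCentral
      (≤⇒≤ᵇ≡true (subst₂ _≤_ (sym (*-identityʳ c)) (sym (*-identityʳ d)) (<⇒≤ c<d))))
    upperTriangle : signsS (tri (1 , 1) (1 , 0) (0 , 1)) ≡ [ false ]
    upperTriangle = triangleSign-cong
      (<⇒<ᵇ≡true (subst₂ _<_ (sym (*-identityʳ c)) (sym (*-identityʳ d)) c<d))
      (≥⇒<ᵇ≡false (subst (_≤ c * 1) (sym (*-zeroʳ d)) z≤n))
      (<⇒<ᵇ≡true (subst₂ _<_ (sym (*-zeroʳ c)) (sym (*-identityʳ d)) (s≤s z≤n)))

  signSeq-s : signSeq true k (c , d) ≡ false ∷ false ∷ gs
  signSeq-s = trans (cong (signList true k c d) items-s) (cong (false ∷_) signsS-restS)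

  gs-last : lastOr false gs ≡ true
  gs-last = trans (cong (lastOr false) (sym signsS-restS)) (signs-last true k c′ d′ restS items-s)

  private
    junction : List Item
    junction = edge (b′ , a) (b , a) ∷ squareItems (b′ , a) ++ edge (b , a) (b , suc a) ∷ translateItem lowerTri₀ ∷ map translateItem restS

    items-t : items (squares (a + c) (b + d)) ≡ (lowerTri₀ ∷ restR) ++ junction
    items-t with squares-last a′ b′ | squares-first c′ d′
    ... | initR , squaresR≡ | squares′ , squaresS≡ = begin
      items (squares (a + c) (b + d))
        ≡⟨ cong items (trans squares-mediant (cong₂ (λ r s → r ++ (b′ , a) ∷ map translate s) squaresR≡ squaresS≡)) ⟩
      items ((initR ++ [ (b′ , a′) ]) ++ (b′ , a) ∷ map translate ((0 , 0) ∷ squares′))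
        ≡⟨ cong items (++-assoc initR [ (b′ , a′) ] _) ⟩
      items (initR ++ (b′ , a′) ∷ (b′ , a) ∷ map translate ((0 , 0) ∷ squares′))
        ≡⟨ items-++ initR (b′ , a′) (b′ , a) (map translate ((0 , 0) ∷ squares′)) ⟩
      items (initR ++ [ (b′ , a′) ]) ++ commonSide (b′ , a′) (b′ , a) ∷ squareItems (b′ , a)
        ++ commonSide (b′ , a) (b , a) ∷ translated
        ≡⟨ cong₂ (λ is side → is ++ side ∷ squareItems (b′ , a) ++ commonSide (b′ , a) (b , a) ∷ translated)
                 (trans (cong items (sym squaresR≡)) items-r) belowSide ⟩
      (lowerTri₀ ∷ restR) ++ edge (b′ , a) (b , a) ∷ squareItems (b′ , a)
        ++ commonSide (b′ , a) (b , a) ∷ translated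
        ≡⟨ cong₂ (λ side is → (lowerTri₀ ∷ restR) ++ edge (b′ , a) (b , a) ∷ squareItems (b′ , a) ++ side ∷ is) rightSide
                 (trans (items-translate ((0 , 0) ∷ squares′)) (cong (map translateItem) (trans (cong items (sym squaresS≡)) items-s))) ⟩
      (lowerTri₀ ∷ restR) ++ junction ∎
      where
      open ≡-Reasoning
      translated : List Item
      translated = items (map translate ((0 , 0) ∷ squares′))
      belowSide : commonSide (b′ , a′) (b′ , a) ≡ edge (b′ , a) (b , a)
      belowSide = cong (λ same → if same then edge (b , a′) (b , a) else edge (b′ , a) (b , a))
                       (≢⇒≡ᵇ≡false {b′} {b} (λ b′≡b → 1+n≢n (sym b′≡b)))
      rightSide : commonSide (b′ , a) (b , a) ≡ edge (b , a) (b , suc a)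
      rightSide = cong (λ same → if same then edge (b , a) (b , suc a) else edge (b′ , suc a) (b , suc a)) (≡ᵇ-refl b)

    ++-cong⁶ : ∀ {X : Set} {u₁ u₂ u₃ u₄ u₅ u₆ v₁ v₂ v₃ v₄ v₅ v₆ zs : List X} →
      u₁ ≡ v₁ → u₂ ≡ v₂ → u₃ ≡ v₃ → u₄ ≡ v₄ → u₅ ≡ v₅ → u₆ ≡ v₆ →
      u₁ ++ u₂ ++ u₃ ++ u₄ ++ u₅ ++ u₆ ++ zs ≡ v₁ ++ v₂ ++ v₃ ++ v₄ ++ v₅ ++ v₆ ++ zs
    ++-cong⁶ refl refl refl refl refl refl = refl

    -- Between r and s, L_t crosses the edge below the junction square (k signs −), the
    -- junction square (−, k signs −, −), its right edge (k signs −) and then the first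
    -- triangle of the translated L_s, which is + here although it is − in G⁺(k, s).
    junction-signs : concatMap signsT junction ≡ replicate (suc (suc (3 * k))) false ++ true ∷ concatMap signsT (map translateItem restS)
    junction-signs = begin
      signsT (edge (b′ , a) (b , a)) ++ signsT (tri (b′ , a) (b , a) (b′ , suc a)) ++ signsT (edge (b′ , suc a) (b , a))
        ++ signsT (tri (b , suc a) (b , a) (b′ , suc a)) ++ signsT (edge (b , a) (b , suc a)) ++ signsT (translateItem lowerTri₀) ++ rest
        ≡⟨ ++-cong⁶ (cong (replicate k ∘ not) junction-bottomEdge-midOnOrAbove)
                    (triangleSign-cong junction-lowerLeft-above junction-lowerRight-notAbove junction-upperLeft-above)
                    (cong (replicate k ∘ not) junction-diagonal-midOnOrAbove)
                    (triangleSign-cong junction-upperRight-above junction-lowerRight-notAbove junction-upperLeft-above)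
                    (cong (replicate k ∘ not) junction-rightEdge-midOnOrAbove)
                    (triangleSign-cong junction-lowerRight-notAbove beyondJunction-notAbove junction-upperRight-above) ⟩
      replicate k false ++ replicate (suc k) false ++ replicate (suc k) false ++ true ∷ rest
        ≡⟨ cong (replicate k false ++_) (replicate-+-++ false (suc k) (suc k) (true ∷ rest)) ⟩
      replicate k false ++ replicate (suc k + suc k) false ++ true ∷ rest
        ≡⟨ replicate-+-++ false k (suc k + suc k) (true ∷ rest) ⟩
      replicate (k + (suc k + suc k)) false ++ true ∷ rest
        ≡⟨ cong (λ n → replicate n false ++ true ∷ rest) (identity k) ⟩
      replicate (suc (suc (3 * k))) false ++ true ∷ rest ∎
      where
      open ≡-Reasoning
      rest : List Bool
      rest = concatMap signsT (map translateItem restS)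
      identity : ∀ k → k + (suc k + suc k) ≡ suc (suc (3 * k))
      identity = solve-∀

  signSeq-t : signSeq false k (a + c , b + d) ≡ (false ∷ gr) ++ replicate (suc (suc (3 * k))) false ++ true ∷ false ∷ gs
  signSeq-t = begin
    signList false k (a + c) (b + d) (items (squares (a + c) (b + d)))  ≡⟨ cong (signList false k (a + c) (b + d)) items-t ⟩
    false ∷ concatMap signsT (restR ++ junction)                         ≡⟨ cong (false ∷_) (concatMap-++ signsT restR junction) ⟩
    false ∷ concatMap signsT restR ++ concatMap signsT junction          ≡⟨ cong (λ xs → false ∷ xs ++ concatMap signsT junction) r-agrees ⟩
    false ∷ gr ++ concatMap signsT junction                             ≡⟨ cong (λ xs → false ∷ gr ++ xs) junction-signs ⟩
    false ∷ gr ++ replicate (suc (suc (3 * k))) false ++ true ∷ concatMap signsT (map translateItem restS)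
      ≡⟨ cong (λ xs → false ∷ gr ++ replicate (suc (suc (3 * k))) false ++ true ∷ xs) (trans s-agrees signsS-restS) ⟩
    false ∷ gr ++ replicate (suc (suc (3 * k))) false ++ true ∷ false ∷ gs ∎
    where
    open ≡-Reasoning
    r-agrees : concatMap signsT restR ≡ gr
    r-agrees = sym (concatMap-All-cong (tail (subst (All _) items-r signs-r)))
    s-agrees : concatMap signsT (map translateItem restS) ≡ concatMap signsS restS
    s-agrees = trans (concatMap-map signsT translateItem restS)
                     (sym (concatMap-All-cong (tail (subst (All _) items-s signs-s))))

open HirzebruchJung using (cfToHJ)
open SignRuns using (isHJ-runs; isHJ-splice)
open Comparisons using (refute; _⊕_; _⊛_)
open import Data.Bool using (true; false)
open import Data.Nat
open import Data.Nat.Properties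
open import Data.Nat.Tactic.RingSolver using (solve-∀; solve)
open import Data.List using (List; []; _∷_; _++_; foldl; replicate)
open import Data.Product using (Σ; _×_; _,_; proj₁; proj₂)
open import Data.Empty using (⊥; ⊥-elim)
open import Relation.Binary.PropositionalEquality
open import Relation.Nullary using (yes; no)

HJSplitting : ℕ → Frac → Frac → Frac → Set
HJSplitting k r t s = Σ (List ℕ) λ lr → Σ (List ℕ) λ ls →
  IsHJ (G⁺ k r) lr × IsHJ (G⁺ k s) ls × IsHJ (F⁺ k t) (lr ++ (3 * k + 4) ∷ ls)

hjSplitting-mediant : ∀ k a′ b′ c′ d′ → suc b′ * suc c′ ≡ suc a′ * suc d′ + 1 → suc c′ < suc d′ →
  HJSplitting k (suc a′ , suc b′) (suc a′ + suc c′ , suc b′ + suc d′) (suc c′ , suc d′)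
hjSplitting-mediant k a′ b′ c′ d′ det c<d = lr , ls , isHJ-r , isHJ-s , isHJ-t
  where
  open MediantSigns k a′ b′ c′ d′ det c<d
  lr ls : List ℕ
  lr = cfToHJ (runs (false ∷ gr))
  ls = cfToHJ (runs (false ∷ false ∷ gs))
  isHJ-r : IsHJ (G⁺ k (suc a′ , suc b′)) lr
  isHJ-r = subst (λ signs → IsHJ (cf (runs signs)) lr) (sym signSeq-r) (isHJ-runs gr gr-last)
  isHJ-s : IsHJ (G⁺ k (suc c′ , suc d′)) ls
  isHJ-s = subst (λ signs → IsHJ (cf (runs signs)) ls) (sym signSeq-s) (isHJ-runs (false ∷ gs) gs-last)
  isHJ-t : IsHJ (F⁺ k (suc a′ + suc c′ , suc b′ + suc d′)) (lr ++ (3 * k + 4) ∷ ls)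
  isHJ-t = subst₂ (λ signs n → IsHJ (cf (runs signs)) (lr ++ n ∷ ls)) (sym signSeq-t) (sym (+-suc (3 * k) 3))
                  (isHJ-splice (suc (3 * k)) gr gs gr-last gs-last)

FareyTriple : Vertex → Set
FareyTriple ((a , b) , t , (c , d)) = t ≡ mediant (a , b) (c , d) × b * c ≡ a * d + 1

fareyTriple-child : ∀ v dir → FareyTriple v → FareyTriple (child v dir)
fareyTriple-child ((a , b) , _ , (c , d)) left (refl , det) = refl , (begin
  b * (a + c)           ≡⟨ *-distribˡ-+ b a c ⟩
  b * a + b * c         ≡⟨ cong (b * a +_) det ⟩
  b * a + (a * d + 1)   ≡⟨ identity a b d ⟩
  a * (b + d) + 1       ∎)
  where
  open ≡-Reasoning
  identity : ∀ a b d → b * a + (a * d + 1) ≡ a * (b + d) + 1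
  identity = solve-∀
fareyTriple-child ((a , b) , _ , (c , d)) right (refl , det) = refl , (begin
  (b + d) * c           ≡⟨ *-distribʳ-+ c b d ⟩
  b * c + d * c         ≡⟨ cong (_+ d * c) det ⟩
  a * d + 1 + d * c     ≡⟨ identity a c d ⟩
  (a + c) * d + 1       ∎)
  where
  open ≡-Reasoning
  identity : ∀ a c d → a * d + 1 + d * c ≡ (a + c) * d + 1
  identity = solve-∀

fareyTriple-foldl : ∀ ds v → FareyTriple v → FareyTriple (foldl child v ds)
fareyTriple-foldl [] v farey = farey
fareyTriple-foldl (dir ∷ ds) v farey = fareyTriple-foldl ds (child v dir) (fareyTriple-child v dir farey)

fareyTriple-vertexAt : ∀ p → FareyTriple (vertexAt p)
fareyTriple-vertexAt p = fareyTriple-foldl p root (refl , refl)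

right-neighbour-≥1 : ∀ a b c d → b * suc c ≡ a * suc d + 1 → a + suc c < b + suc d → suc d ≤ suc c → c ≡ 0 × d ≡ 0
right-neighbour-≥1 a b zero zero _ _ _ = refl , refl
right-neighbour-≥1 a b zero (suc d) _ _ (s≤s ())
right-neighbour-≥1 a b (suc c) d det t<1 d≤c = ⊥-elim (cert (≤-reflexive det) t<1 d≤c (s≤s (s≤s z≤n)))
  where
  cert : ∀ {a b c d} → b * c ≤ a * d + 1 → suc (a + c) ≤ b + d → d ≤ c → 2 ≤ c → ⊥
  cert {a} {b} {c} {d} det≤ t<1 d≤c 2≤c = refute 0 (c ⊛ t<1 ⊕ (c + a) ⊛ d≤c ⊕ det≤ ⊕ 2≤c) (solve (a ∷ b ∷ c ∷ d ∷ []))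

hjSplitting-farey : ∀ k a b c d → b * c ≡ a * d + 1 → a + c < b + d → (a , b) ≢ (0 , 1) → (c , d) ≢ (1 , 1) →
  HJSplitting k (a , b) (a + c , b + d) (c , d)
hjSplitting-farey k zero b c d det _ r≢0/1 _ = ⊥-elim (r≢0/1 (cong (0 ,_) (m*n≡1⇒m≡1 b c det)))
hjSplitting-farey k (suc a′) zero c d det _ _ _ = ⊥-elim (0≢1+n (trans det (+-comm (suc a′ * d) 1)))
hjSplitting-farey k (suc a′) (suc b′) zero d det _ _ _ =
  ⊥-elim (0≢1+n (trans (sym (*-zeroʳ (suc b′))) (trans det (+-comm (suc a′ * d) 1))))
hjSplitting-farey k (suc a′) (suc b′) (suc c′) zero det t<1 _ _ = ⊥-elim (<⇒≱ t<1 (s≤s (subst (_≤ a′ + suc c′) (sym b≡0) z≤n)))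
  where
  b≡0 : b′ + 0 ≡ 0
  b≡0 = trans (+-identityʳ b′) (suc-injective (m*n≡1⇒m≡1 (suc b′) (suc c′) (trans det (cong (_+ 1) (*-zeroʳ (suc a′))))))
hjSplitting-farey k (suc a′) (suc b′) (suc c′) (suc d′) det t<1 _ s≢1/1 with suc d′ ≤? suc c′
... | no d≰c = hjSplitting-mediant k a′ b′ c′ d′ det (≰⇒> d≰c)
... | yes d≤c with right-neighbour-≥1 (suc a′) (suc b′) c′ d′ det t<1 d≤c
...   | refl , refl = ⊥-elim (s≢1/1 refl)

theorem8p16 : (k : ℕ) (p : List Dir)
    → 0 < proj₁ (vM p) → proj₁ (vM p) < proj₂ (vM p)
    → vL p ≢ (0 , 1) → vR p ≢ (1 , 1)
    → Σ (List ℕ) λ lr → Σ (List ℕ) λ ls →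
        IsHJ (G⁺ k (vL p)) lr × IsHJ (G⁺ k (vR p)) ls
        × IsHJ (F⁺ k (vM p)) (lr ++ (3 * k + 4) ∷ ls)
theorem8p16 k p _ with vL p | vM p | vR p | fareyTriple-vertexAt p
... | (a , b) | .(a + c , b + d) | (c , d) | refl , det = hjSplitting-farey k a b c d det
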